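{- Let $n\ge1$ and $k\leq n/2$, and let $V$ be an $n$-dimensional vector space over a field $\mathbb{F}$. If $K$ and $L$ are nonzero cross-annihilating subspaces of $\bigwedge^{k}V$, then \[ \dim K+\dim L\leq\binom{n}{k}-\binom{n-k}{k}+1. \]
   Context: The paper assumes throughout that the field $\mathbb{F}$ has characteristic different from $2$. $\bigwedge V$ denotes the exterior algebra of $V$ and $\bigwedge^k V$ its degree-$k$ component. Subsets $K,L\subseteq\bigwedge V$ are cross-annihilating if $x\wedge y=0$ for every $x\in K$ and $y\in L$. -}

module Defs where

open import Level using (Level; _⊔_) renaming (suc to lsuc)
open import Algebra.Bundles using (CommutativeRing)
open import Data.Nat using (ℕ; zero; suc) renaming (_+_ to _+ℕ_)
open import Data.Bool using (Bool; true; false; if_then_else_)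
open import Data.Vec using (Vec; []; _∷_)
open import Data.Fin using (Fin)
import Data.Fin as Fin
open import Data.Fin.Subset using (Subset; ∣_∣)
open import Data.List using (List; []; _∷_; map; _++_; foldr)
open import Data.Product using (Σ; _×_; ∃)
open import Relation.Nullary using (¬_)
open import Relation.Binary.PropositionalEquality using (_≡_)

record Field (c ℓ : Level) : Set (lsuc (c ⊔ ℓ)) where
  field
    commutativeRing : CommutativeRing c ℓ
  open CommutativeRing commutativeRing public
  field
    1≉0     : ¬ (1# ≈ 0#)
    inverse : ∀ x → ¬ (x ≈ 0#) → Σ Carrier λ y → (x * y) ≈ 1#

allSubsets : (m : ℕ) → List (Subset m)
allSubsets zero    = [] ∷ []
allSubsets (suc m) = map (false ∷_) (allSubsets m) ++ map (true ∷_) (allSubsets m)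

isSplit : ∀ {m} → Subset m → Subset m → Subset m → Bool
isSplit []            []            []            = true
isSplit (false ∷ A)   (false ∷ B)   (false ∷ S)   = isSplit A B S
isSplit (true ∷ A)    (false ∷ B)   (true ∷ S)    = isSplit A B S
isSplit (false ∷ A)   (true ∷ B)    (true ∷ S)    = isSplit A B S
isSplit (_ ∷ A)       (_ ∷ B)       (_ ∷ S)       = false

inversions : ∀ {m} → Subset m → Subset m → ℕ
inversions []      []            = zero
inversions (_ ∷ A) (false ∷ B)   = inversions A B
inversions (_ ∷ A) (true ∷ B)    = ∣ A ∣ +ℕ inversions A B

-- The exterior algebra ⋀ V of V = 𝔽ⁿ (standard basis e₀,…,e_{n-1}).
-- A multivector is its coordinate function on the basis
-- e_S = e_{s₁} ∧ … ∧ e_{s_r}  (s₁ < … < s_r, S = {s₁,…,s_r} ⊆ Fin n).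

module Exterior {c ℓ : Level} (F : Field c ℓ) (n : ℕ) where
  open Field F

  MV : Set c
  MV = Subset n → Carrier

  _≈ᵥ_ : MV → MV → Set ℓ
  x ≈ᵥ y = ∀ S → x S ≈ y S

  0ᵥ : MV
  0ᵥ S = 0#

  _+ᵥ_ : MV → MV → MV
  (x +ᵥ y) S = x S + y S

  _·_ : Carrier → MV → MV
  (a · x) S = a * x S

  signPow : ℕ → Carrier
  signPow zero    = 1#
  signPow (suc k) = - signPow k

  sumList : List (Subset n) → (Subset n → Carrier) → Carrier
  sumList xs f = foldr (λ A acc → f A + acc) 0# xs

  -- wedge product: e_A ∧ e_B = (-1)^{inv(A,B)} e_{A∪B} if A ∩ B = ∅, else 0
  _∧_ : MV → MV → MV
  (x ∧ y) S = sumList (allSubsets n) λ A → sumList (allSubsets n) λ B →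
    if isSplit A B S then signPow (inversions A B) * (x A * y B) else 0#

  InDegree : ℕ → MV → Set ℓ
  InDegree k x = ∀ S → ¬ (∣ S ∣ ≡ k) → x S ≈ 0#

  record IsSubspace {p : Level} (P : MV → Set p) : Set (c ⊔ ℓ ⊔ p) where
    field
      resp  : ∀ {x y} → x ≈ᵥ y → P x → P y
      zero∈ : P 0ᵥ
      +∈    : ∀ {x y} → P x → P y → P (x +ᵥ y)
      ·∈    : ∀ a {x} → P x → P (a · x)

  sumFin : (d : ℕ) → (Fin d → Carrier) → Carrier
  sumFin zero    f = 0#
  sumFin (suc d) f = f Fin.zero + sumFin d (λ i → f (Fin.suc i))

  linComb : {d : ℕ} → (Fin d → Carrier) → (Fin d → MV) → MV
  linComb {d} a b S = sumFin d (λ i → a i * b i S)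

  record IsBasis {p : Level} (P : MV → Set p) {d : ℕ} (b : Fin d → MV) : Set (c ⊔ ℓ ⊔ p) where
    field
      member   : ∀ i → P (b i)
      linIndep : ∀ (a : Fin d → Carrier) → linComb a b ≈ᵥ 0ᵥ → ∀ i → a i ≈ 0#
      spanning : ∀ x → P x → Σ (Fin d → Carrier) λ a → x ≈ᵥ linComb a b

  HasDim : {p : Level} → (MV → Set p) → ℕ → Set (c ⊔ ℓ ⊔ p)
  HasDim P d = Σ (Fin d → MV) λ b → IsBasis P b

  CrossAnnihilating : {p q : Level} → (MV → Set p) → (MV → Set q) → Set (c ⊔ ℓ ⊔ p ⊔ q)
  CrossAnnihilating K L = ∀ x y → K x → L y → (x ∧ y) ≈ᵥ 0ᵥ

-- Order the subsets of {0,…,n−1} lexicographically and call the largest S with x_S ≠ 0 the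
-- leading subset of a nonzero x = Σ x_S e_S in ⋀V.  Gaussian elimination shows that a
-- d-dimensional subspace has d distinct leading subsets, and these are k-subsets inside ⋀^k V.
-- If x and y have disjoint leading subsets A and B, the coefficient of e_{A ∪ B} in x ∧ y is
-- ±x_A y_B ≠ 0, since every other split A′ ⊔ B′ = A ∪ B has A′ > A or B′ > B.  So the leading
-- subsets of cross-annihilating K and L form nonempty cross-intersecting k-uniform families,
-- and the bound is the Hilton–Milner-type inequality |𝒜| + |ℬ| ≤ C(n,k) − C(n−k,k) + 1 for
-- those.  It is proved by compressing both families until they are shifted (a potential
-- function decreases) and then by induction on n, splitting each family according to whether
-- its members contain the first element: the parts avoiding it satisfy the same bound one
-- dimension lower, and the parts containing it are handled by that bound for k − 1 or, if one
-- of them is empty, by counting the sets that meet a fixed k-set.  Equality of field elements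
-- is not decidable, so leading subsets only exist under double negation; this is harmless
-- because the conclusion is a decidable inequality.

{-# OPTIONS --safe #-}
module Submission where

open import Level using (Level; _⊔_)
open import Algebra.Bundles using (CommutativeMonoid)
open import Data.Bool using (Bool; true; false; _∧_; _∨_; not; if_then_else_)
import Data.Bool as Bool
open import Data.Bool.Properties as Bool
  using (¬-not; not-¬; ∧-identityʳ; ∧-zeroʳ; ∨-zeroʳ; ∧-comm; T-≡; ∨-commutativeMonoid)
open import Data.Fin using (Fin; zero; suc; punchIn)
import Data.Fin.Properties as Fin
open import Data.Fin.Properties using (any?)
open import Data.Fin.Subset using (Subset; ∣_∣; ∁; _∪_)
open import Data.Fin.Subset.Properties using (∣p∣≤n; ∣∁p∣≡n∸∣p∣; anySubset?)
open import Data.List using (List; []; _∷_; _++_; map; foldr)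
open import Data.Nat using (ℕ; zero; suc; _+_; _*_; _∸_; _≤_; _<_; z≤n; s≤s; s≤s⁻¹; _≡ᵇ_; _≤?_)
import Data.Nat as ℕ
open import Data.Nat.Combinatorics using (_C_; nCk+nC[k+1]≡[n+1]C[k+1]; nCn≡1)
open import Data.Nat.Induction using (<-wellFounded)
open import Data.Nat.Properties
open import Data.Nat.Tactic.RingSolver using (solve-∀)
open import Data.Product using (Σ; ∃; ∃₂; _×_; _,_; proj₁; proj₂; uncurry)
open import Data.Sum using (_⊎_; inj₁; inj₂; [_,_])
import Data.Sum as Sum
open import Data.Vec using ([]; _∷_; lookup; _[_]≔_)
import Data.Vec
open import Data.Vec.Properties using (lookup∘updateAt; []≔-idempotent; []≔-lookup; ≡-dec)
open import Data.Vec.Functional using (insertAt; removeAt)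
open import Data.Vec.Functional.Properties using (insertAt-lookup; insertAt-punchIn)
open import Data.Vec.Relation.Binary.Lex.Strict as Lex using (Lex-<; this; next; base)
open import Data.Vec.Relation.Binary.Pointwise.Inductive using (Pointwise-≡⇒≡; ≡⇒Pointwise-≡)
open import Function using (_∘_; const; _on_)
open import Function.Bundles using (Equivalence)
open import Function.Definitions using (Injective)
open import Induction.WellFounded using (WfRec; module All)
import Relation.Binary.Construct.On as On
open import Relation.Binary.Definitions using (DecidableEquality; Trichotomous; tri<; tri≈; tri>)
open import Relation.Binary.PropositionalEquality
  using (_≡_; _≢_; refl; sym; trans; cong; cong₂; subst; subst₂; module ≡-Reasoning)
open import Relation.Binary.PropositionalEquality.Properties using (isEquivalence)
open import Relation.Binary.Structures using (IsEquivalence)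
open import Relation.Nullary using (¬_; Dec; yes; no; ¬?; contradiction)
open import Relation.Nullary.Decidable
  using (map′; _⊎-dec_; decidable-stable; does; dec-true; ¬¬-excluded-middle)
open import Relation.Nullary.Negation using (¬¬-map; negated-stable)
open import Algebra.Properties.CommutativeSemigroup +-commutativeSemigroup
  using () renaming (interchange to +-interchange; x∙yz≈y∙xz to x+[y+z]≡y+[x+z])
open import Algebra.Properties.CommutativeSemigroup (CommutativeMonoid.commutativeSemigroup ∨-commutativeMonoid)
  using () renaming (x∙yz≈y∙xz to x∨[y∨z]≡y∨[x∨z])

open import Defs

private variable
  n m k r d : ℕ

toℕ : Bool → ℕ
toℕ false = 0
toℕ true  = 1

∑ : (Subset n → ℕ) → ℕ
∑ {zero}  f = f []
∑ {suc n} f = ∑ (λ X → f (false ∷ X)) + ∑ (λ X → f (true ∷ X))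

∑-cong : {f g : Subset n → ℕ} → (∀ X → f X ≡ g X) → ∑ f ≡ ∑ g
∑-cong {zero}  f≗g = f≗g []
∑-cong {suc n} f≗g = cong₂ _+_ (∑-cong λ X → f≗g (false ∷ X)) (∑-cong λ X → f≗g (true ∷ X))

∑-zero : {f : Subset n → ℕ} → (∀ X → f X ≡ 0) → ∑ f ≡ 0
∑-zero {zero}  f≗0 = f≗0 []
∑-zero {suc n} f≗0 = cong₂ _+_ (∑-zero λ X → f≗0 (false ∷ X)) (∑-zero λ X → f≗0 (true ∷ X))

∑-mono-≤ : {f g : Subset n → ℕ} → (∀ X → f X ≤ g X) → ∑ f ≤ ∑ g
∑-mono-≤ {zero}  f≤g = f≤g []
∑-mono-≤ {suc n} f≤g = +-mono-≤ (∑-mono-≤ λ X → f≤g (false ∷ X)) (∑-mono-≤ λ X → f≤g (true ∷ X))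

∑-mono-< : {f g : Subset n → ℕ} → (∀ X → f X ≤ g X) → ∀ X₀ → f X₀ < g X₀ → ∑ f < ∑ g
∑-mono-< {zero}  f≤g [] f<g = f<g
∑-mono-< {suc n} f≤g (false ∷ X₀) f<g =
  +-mono-<-≤ (∑-mono-< (λ X → f≤g (false ∷ X)) X₀ f<g) (∑-mono-≤ λ X → f≤g (true ∷ X))
∑-mono-< {suc n} f≤g (true ∷ X₀) f<g =
  +-mono-≤-< (∑-mono-≤ λ X → f≤g (false ∷ X)) (∑-mono-< (λ X → f≤g (true ∷ X)) X₀ f<g)

∑-distrib-+ : (f g : Subset n → ℕ) → ∑ (λ X → f X + g X) ≡ ∑ f + ∑ g
∑-distrib-+ {zero}  f g = refl
∑-distrib-+ {suc n} f g = begin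
  ∑ (λ X → f (false ∷ X) + g (false ∷ X)) + ∑ (λ X → f (true ∷ X) + g (true ∷ X))
    ≡⟨ cong₂ _+_ (∑-distrib-+ f₀ g₀) (∑-distrib-+ f₁ g₁) ⟩
  (∑ f₀ + ∑ g₀) + (∑ f₁ + ∑ g₁)
    ≡⟨ +-interchange (∑ f₀) (∑ g₀) (∑ f₁) (∑ g₁) ⟩
  (∑ f₀ + ∑ f₁) + (∑ g₀ + ∑ g₁) ∎
  where
  open ≡-Reasoning
  f₀ f₁ g₀ g₁ : Subset n → ℕ
  f₀ X = f (false ∷ X)
  f₁ X = f (true ∷ X)
  g₀ X = g (false ∷ X)
  g₁ X = g (true ∷ X)

∑-∁ : (f : Subset n → ℕ) → ∑ (λ X → f (∁ X)) ≡ ∑ f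
∑-∁ {zero}  f = refl
∑-∁ {suc n} f = trans (cong₂ _+_ (∑-∁ λ X → f (true ∷ X)) (∑-∁ λ X → f (false ∷ X)))
                      (+-comm (∑ λ X → f (true ∷ X)) _)

∑-split-at : (x : Fin n) (h : Bool → Subset n → ℕ) →
  ∑ (λ X → h (lookup X x) (X [ x ]≔ false)) + ∑ (λ X → h (lookup X x) (X [ x ]≔ true)) ≡
  ∑ (h false) + ∑ (h true)
∑-split-at zero    h = +-interchange (∑ λ Z → h false (false ∷ Z)) (∑ λ Z → h true (false ∷ Z))
                                     (∑ λ Z → h false (true ∷ Z))  (∑ λ Z → h true (true ∷ Z))
∑-split-at (suc x) h = begin
  (∑ (λ Z → h (lookup Z x) (false ∷ Z [ x ]≔ false)) + ∑ (λ Z → h (lookup Z x) (true ∷ Z [ x ]≔ false))) +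
  (∑ (λ Z → h (lookup Z x) (false ∷ Z [ x ]≔ true))  + ∑ (λ Z → h (lookup Z x) (true ∷ Z [ x ]≔ true)))
    ≡⟨ +-interchange (∑ λ Z → h (lookup Z x) (false ∷ Z [ x ]≔ false)) _ _ _ ⟩
  (∑ (λ Z → h (lookup Z x) (false ∷ Z [ x ]≔ false)) + ∑ (λ Z → h (lookup Z x) (false ∷ Z [ x ]≔ true))) +
  (∑ (λ Z → h (lookup Z x) (true ∷ Z [ x ]≔ false))  + ∑ (λ Z → h (lookup Z x) (true ∷ Z [ x ]≔ true)))
    ≡⟨ cong₂ _+_ (∑-split-at x λ b Z → h b (false ∷ Z)) (∑-split-at x λ b Z → h b (true ∷ Z)) ⟩
  (∑ (λ Z → h false (false ∷ Z)) + ∑ (λ Z → h true (false ∷ Z))) +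
  (∑ (λ Z → h false (true ∷ Z))  + ∑ (λ Z → h true (true ∷ Z)))
    ≡⟨ +-interchange (∑ λ Z → h false (false ∷ Z)) _ _ _ ⟩
  ∑ (h false) + ∑ (h true) ∎
  where open ≡-Reasoning

Family : ℕ → Set
Family n = Subset n → Bool

count : Family n → ℕ
count A = ∑ (λ X → toℕ (A X))

Uniform : ℕ → Family n → Set
Uniform k A = ∀ X → A X ≡ true → ∣ X ∣ ≡ k

meets : Subset n → Subset n → Bool
meets []      []      = false
meets (a ∷ X) (b ∷ Y) = (a ∧ b) ∨ meets X Y

CrossIntersecting : Family n → Family n → Set
CrossIntersecting A B = ∀ X Y → A X ≡ true → B Y ≡ true → meets X Y ≡ true

NonEmpty : Family n → Set
NonEmpty A = Σ (Subset _) λ X → A X ≡ true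

record CrossIntersectingPair (k : ℕ) (A B : Family n) : Set where
  field
    uniformˡ  : Uniform k A
    uniformʳ  : Uniform k B
    cross     : CrossIntersecting A B
    nonemptyˡ : NonEmpty A
    nonemptyʳ : NonEmpty B

-- C(n,k) − C(n−k,k) + 1, with the subtraction moved to the left-hand side
HiltonMilnerBound : ℕ → Family n → Family n → Set
HiltonMilnerBound {n} k A B = count A + count B + (n ∸ k) C k ≤ n C k + 1

toℕ-true : ∀ {b} → b ≡ true → 1 ≤ toℕ b
toℕ-true refl = ≤-refl

toℕ-∧-≤ʳ : ∀ a b → toℕ (a ∧ b) ≤ toℕ b
toℕ-∧-≤ʳ false b = z≤n
toℕ-∧-≤ʳ true  b = ≤-refl

meets-comm : (X Y : Subset n) → meets X Y ≡ meets Y X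
meets-comm []      []      = refl
meets-comm (a ∷ X) (b ∷ Y) = cong₂ _∨_ (∧-comm a b) (meets-comm X Y)

meets-∁ : (X : Subset n) → meets (∁ X) X ≡ false
meets-∁ []          = refl
meets-∁ (false ∷ X) = meets-∁ X
meets-∁ (true  ∷ X) = meets-∁ X

meets-empty : (X Y : Subset n) → ∣ X ∣ ≡ 0 → meets X Y ≡ false
meets-empty []          []      _  = refl
meets-empty (false ∷ X) (b ∷ Y) ∣X∣≡0 = meets-empty X Y ∣X∣≡0

meets-at : (X Y : Subset n) (x : Fin n) →
           meets X Y ≡ (lookup X x ∧ lookup Y x) ∨ meets (X [ x ]≔ false) (Y [ x ]≔ false)
meets-at (a ∷ X) (b ∷ Y) zero    = refl
meets-at (a ∷ X) (b ∷ Y) (suc x) =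
  trans (cong ((a ∧ b) ∨_) (meets-at X Y x))
        (x∨[y∨z]≡y∨[x∨z] (a ∧ b) (lookup X x ∧ lookup Y x) (meets (X [ x ]≔ false) (Y [ x ]≔ false)))

meets-insert : (X Y : Subset n) (x : Fin n) → lookup X x ≡ false → meets X (Y [ x ]≔ true) ≡ meets X Y
meets-insert X Y x Xx = begin
  meets X (Y [ x ]≔ true)                                                ≡⟨ meets-at X (Y [ x ]≔ true) x ⟩
  (lookup X x ∧ lookup (Y [ x ]≔ true) x) ∨ meets X₀ (Y [ x ]≔ true [ x ]≔ false)
    ≡⟨ cong₂ (λ a Z → (a ∧ lookup (Y [ x ]≔ true) x) ∨ meets X₀ Z) Xx ([]≔-idempotent Y x) ⟩
  meets X₀ (Y [ x ]≔ false)
    ≡⟨ cong (λ a → (a ∧ lookup Y x) ∨ meets X₀ (Y [ x ]≔ false)) Xx ⟨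
  (lookup X x ∧ lookup Y x) ∨ meets X₀ (Y [ x ]≔ false)                  ≡⟨ meets-at X Y x ⟨
  meets X Y                                                              ∎
  where
  open ≡-Reasoning
  X₀ = X [ x ]≔ false

∣∷∣ : ∀ b (X : Subset n) → ∣ b ∷ X ∣ ≡ toℕ b + ∣ X ∣
∣∷∣ false X = refl
∣∷∣ true  X = refl

∣[]≔∣ : (X : Subset n) (x : Fin n) (b : Bool) → toℕ (lookup X x) + ∣ X [ x ]≔ b ∣ ≡ toℕ b + ∣ X ∣
∣[]≔∣ (a ∷ X) zero    b = begin
  toℕ a + ∣ b ∷ X ∣       ≡⟨ cong (toℕ a +_) (∣∷∣ b X) ⟩
  toℕ a + (toℕ b + ∣ X ∣) ≡⟨ x+[y+z]≡y+[x+z] (toℕ a) (toℕ b) ∣ X ∣ ⟩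
  toℕ b + (toℕ a + ∣ X ∣) ≡⟨ cong (toℕ b +_) (∣∷∣ a X) ⟨
  toℕ b + ∣ a ∷ X ∣       ∎
  where open ≡-Reasoning
∣[]≔∣ (a ∷ X) (suc x) b = begin
  toℕ (lookup X x) + ∣ a ∷ X [ x ]≔ b ∣       ≡⟨ cong (toℕ (lookup X x) +_) (∣∷∣ a (X [ x ]≔ b)) ⟩
  toℕ (lookup X x) + (toℕ a + ∣ X [ x ]≔ b ∣) ≡⟨ x+[y+z]≡y+[x+z] (toℕ (lookup X x)) (toℕ a) _ ⟩
  toℕ a + (toℕ (lookup X x) + ∣ X [ x ]≔ b ∣) ≡⟨ cong (toℕ a +_) (∣[]≔∣ X x b) ⟩
  toℕ a + (toℕ b + ∣ X ∣)                     ≡⟨ x+[y+z]≡y+[x+z] (toℕ a) (toℕ b) ∣ X ∣ ⟩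
  toℕ b + (toℕ a + ∣ X ∣)                     ≡⟨ cong (toℕ b +_) (∣∷∣ a X) ⟨
  toℕ b + ∣ a ∷ X ∣                           ∎
  where open ≡-Reasoning

free-coordinate : (X : Subset n) → ∣ X ∣ < n → ∃ λ x → lookup X x ≡ false
free-coordinate (false ∷ X) _        = zero , refl
free-coordinate (true  ∷ X) (s≤s lt) = let x , Xx = free-coordinate X lt in suc x , Xx

common-free-coordinate : (X Y : Subset n) → meets X Y ≡ false → ∣ X ∣ + ∣ Y ∣ < n →
                         ∃ λ x → lookup X x ≡ false × lookup Y x ≡ false
common-free-coordinate (false ∷ X) (false ∷ Y) _ _ = zero , refl , refl
common-free-coordinate (true  ∷ X) (false ∷ Y) XY (s≤s lt) =
  let x , Xx , Yx = common-free-coordinate X Y XY lt in suc x , Xx , Yx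
common-free-coordinate {suc n} (false ∷ X) (true ∷ Y) XY (s≤s lt) =
  let x , Xx , Yx = common-free-coordinate X Y XY (subst (_≤ n) (+-suc ∣ X ∣ ∣ Y ∣) lt) in suc x , Xx , Yx
common-free-coordinate (true  ∷ X) (true  ∷ Y) () _

nonempty? : (A : Family n) → Dec (NonEmpty A)
nonempty? A = anySubset? λ X → A X Bool.≟ true

count-empty : (A : Family n) → ¬ NonEmpty A → count A ≡ 0
count-empty A empty = ∑-zero λ X → cong toℕ (¬-not λ AX → empty (X , AX))

pair-sym : {A B : Family n} → CrossIntersectingPair k A B → CrossIntersectingPair k B A
pair-sym p = record
  { uniformˡ = uniformʳ ; uniformʳ = uniformˡ ; nonemptyˡ = nonemptyʳ ; nonemptyʳ = nonemptyˡ
  ; cross = λ X Y BX AY → trans (meets-comm X Y) (cross Y X AY BX) }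
  where open CrossIntersectingPair p

no-pair-of-0-sets : {A B : Family n} → ¬ CrossIntersectingPair 0 A B
no-pair-of-0-sets p = contradiction (trans (sym (cross X Y AX BY)) (meets-empty X Y (uniformˡ X AX))) λ ()
  where
  open CrossIntersectingPair p
  X = proj₁ nonemptyˡ
  AX = proj₂ nonemptyˡ
  Y = proj₁ nonemptyʳ
  BY = proj₂ nonemptyʳ

Sized : ℕ → Family n
Sized r X = ∣ X ∣ ≡ᵇ r

sized : ∀ {r} {X : Subset n} → ∣ X ∣ ≡ r → Sized r X ≡ true
sized {r = r} {X} eq = Equivalence.to T-≡ (≡⇒≡ᵇ ∣ X ∣ r eq)

count-sized : ∀ n r → count (Sized {n} r) ≡ n C r
count-sized zero    zero    = refl
count-sized zero    (suc r) = refl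
count-sized (suc n) zero    = cong₂ _+_ (count-sized n zero) (∑-zero {n} λ _ → refl)
count-sized (suc n) (suc r) = begin
  count (Sized {n} (suc r)) + count (Sized {n} r) ≡⟨ cong₂ _+_ (count-sized n (suc r)) (count-sized n r) ⟩
  n C suc r + n C r                               ≡⟨ +-comm (n C suc r) (n C r) ⟩
  n C r + n C suc r                               ≡⟨ nCk+nC[k+1]≡[n+1]C[k+1] n r ⟩
  suc n C suc r                                   ∎
  where open ≡-Reasoning

count-disjoint : (Z : Subset m) (r : ℕ) → count (λ Y → not (meets Z Y) ∧ Sized r Y) ≡ (m ∸ ∣ Z ∣) C r
count-disjoint []          zero    = refl
count-disjoint []          (suc r) = refl
count-disjoint {suc m} (true ∷ Z) r = trans (cong₂ _+_ (count-disjoint Z r) (∑-zero {m} λ _ → refl)) (+-identityʳ _)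
count-disjoint (false ∷ Z) zero    =
  cong₂ _+_ (count-disjoint Z zero) (∑-zero λ Y → cong toℕ (∧-zeroʳ (not (meets Z Y))))
count-disjoint {suc m} (false ∷ Z) (suc r) = begin
  _ ≡⟨ cong₂ _+_ (count-disjoint Z (suc r)) (count-disjoint Z r) ⟩
  (m ∸ ∣ Z ∣) C suc r + (m ∸ ∣ Z ∣) C r ≡⟨ +-comm ((m ∸ ∣ Z ∣) C suc r) _ ⟩
  (m ∸ ∣ Z ∣) C r + (m ∸ ∣ Z ∣) C suc r ≡⟨ nCk+nC[k+1]≡[n+1]C[k+1] (m ∸ ∣ Z ∣) r ⟩
  suc (m ∸ ∣ Z ∣) C suc r              ≡⟨ cong (_C suc r) (+-∸-assoc 1 (∣p∣≤n Z)) ⟨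
  (suc m ∸ ∣ Z ∣) C suc r              ∎
  where open ≡-Reasoning

meeting-bound : (Z : Subset m) {F : Family m} → (∀ Y → F Y ≡ true → meets Z Y ≡ true × ∣ Y ∣ ≡ r) →
                count F + (m ∸ ∣ Z ∣) C r ≤ m C r
meeting-bound {m} {r} Z {F} F⊆ = begin
  count F + (m ∸ ∣ Z ∣) C r          ≡⟨ cong (count F +_) (count-disjoint Z r) ⟨
  count F + count Disjoint           ≡⟨ ∑-distrib-+ (λ Y → toℕ (F Y)) (λ Y → toℕ (Disjoint Y)) ⟨
  ∑ (λ Y → toℕ (F Y) + toℕ (Disjoint Y)) ≤⟨ ∑-mono-≤ pointwise ⟩
  count {m} (Sized r)                ≡⟨ count-sized m r ⟩
  m C r                              ∎
  where
  open ≤-Reasoning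
  Disjoint : Family m
  Disjoint Y = not (meets Z Y) ∧ Sized r Y
  pointwise : ∀ Y → toℕ (F Y) + toℕ (Disjoint Y) ≤ toℕ (Sized r Y)
  pointwise Y with F Y in FY
  ... | false = toℕ-∧-≤ʳ (not (meets Z Y)) (Sized r Y)
  ... | true = member (proj₁ (F⊆ Y FY)) (sized {X = Y} (proj₂ (F⊆ Y FY)))
    where
    member : ∀ {a s} → a ≡ true → s ≡ true → 1 + toℕ (not a ∧ s) ≤ toℕ s
    member refl refl = ≤-refl

complement-bound : k + k ≡ n → {A B : Family n} → Uniform k A → Uniform k B → CrossIntersecting A B →
                   count A + count B ≤ n C k
complement-bound {k} {n} k+k≡n {A} {B} uA uB cross = begin
  count A + count B                            ≡⟨ cong (_+ count B) (∑-∁ λ X → toℕ (A X)) ⟨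
  ∑ (λ X → toℕ (A (∁ X))) + count B            ≡⟨ ∑-distrib-+ (λ X → toℕ (A (∁ X))) (λ X → toℕ (B X)) ⟨
  ∑ (λ X → toℕ (A (∁ X)) + toℕ (B X))          ≤⟨ ∑-mono-≤ pointwise ⟩
  count {n} (Sized k)                          ≡⟨ count-sized n k ⟩
  n C k                                        ∎
  where
  open ≤-Reasoning
  ∣X∣≡k : ∀ X → ∣ ∁ X ∣ ≡ k → ∣ X ∣ ≡ k
  ∣X∣≡k X ∣∁X∣≡k = begin-equality
    ∣ X ∣             ≡⟨ m∸[m∸n]≡n (∣p∣≤n X) ⟨
    n ∸ (n ∸ ∣ X ∣)   ≡⟨ cong (n ∸_) (trans (sym (∣∁p∣≡n∸∣p∣ X)) ∣∁X∣≡k) ⟩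
    n ∸ k             ≡⟨ cong (_∸ k) k+k≡n ⟨
    k + k ∸ k         ≡⟨ m+n∸n≡m k k ⟩
    k                 ∎
  pointwise : ∀ X → toℕ (A (∁ X)) + toℕ (B X) ≤ toℕ (Sized k X)
  pointwise X with A (∁ X) in A∁X | B X in BX
  ... | true  | true  = contradiction (trans (sym (cross _ _ A∁X BX)) (meets-∁ X)) λ ()
  ... | true  | false = toℕ-true (sized {X = X} (∣X∣≡k X (uA _ A∁X)))
  ... | false | true  = toℕ-true (sized {X = X} (uB X BX))
  ... | false | false = z≤n

0<nCk : k ≤ n → 0 < n C k
0<nCk {zero}  _ = ≤-refl
0<nCk {suc k} {suc n} (s≤s k≤n) =
  ≤-trans (0<nCk k≤n) (≤-trans (m≤m+n (n C k) _) (≤-reflexive (nCk+nC[k+1]≡[n+1]C[k+1] n k)))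

-- Shifting

-- here x exchanges the coordinates 0 and suc x; there s acts on the tail.
data Transposition : ℕ → Set where
  here  : Fin n → Transposition (suc n)
  there : Transposition n → Transposition (suc n)

swap : Transposition n → Subset n → Subset n
swap (here x)  (b ∷ X) = lookup X x ∷ (X [ x ]≔ b)
swap (there s) (b ∷ X) = b ∷ swap s X

swap-involutive : (s : Transposition n) (X : Subset n) → swap s (swap s X) ≡ X
swap-involutive (here x)  (b ∷ X)
  rewrite lookup∘updateAt x {const b} X | []≔-idempotent {x = b} {y = lookup X x} X x | []≔-lookup X x = refl
swap-involutive (there s) (b ∷ X) = cong (b ∷_) (swap-involutive s X)

∣swap∣ : (s : Transposition n) (X : Subset n) → ∣ swap s X ∣ ≡ ∣ X ∣
∣swap∣ (here x)  (b ∷ X) = trans (∣∷∣ (lookup X x) (X [ x ]≔ b)) (trans (∣[]≔∣ X x b) (sym (∣∷∣ b X)))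
∣swap∣ (there s) (b ∷ X) = trans (∣∷∣ b (swap s X)) (trans (cong (toℕ b +_) (∣swap∣ s X)) (sym (∣∷∣ b X)))

meets-swap : (s : Transposition n) (X Y : Subset n) → meets (swap s X) (swap s Y) ≡ meets X Y
meets-swap (here x)  (b ∷ X) (c ∷ Y) = begin
  (X₀ ∧ Y₀) ∨ meets (X [ x ]≔ b) (Y [ x ]≔ c)
    ≡⟨ cong ((X₀ ∧ Y₀) ∨_) (meets-at (X [ x ]≔ b) (Y [ x ]≔ c) x) ⟩
  (X₀ ∧ Y₀) ∨ ((lookup (X [ x ]≔ b) x ∧ lookup (Y [ x ]≔ c) x) ∨
               meets (X [ x ]≔ b [ x ]≔ false) (Y [ x ]≔ c [ x ]≔ false))
    ≡⟨ cong ((X₀ ∧ Y₀) ∨_) (cong₂ _∨_ (cong₂ _∧_ (lookup∘updateAt x X) (lookup∘updateAt x Y))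
                                      (cong₂ meets ([]≔-idempotent X x) ([]≔-idempotent Y x))) ⟩
  (X₀ ∧ Y₀) ∨ ((b ∧ c) ∨ meets (X [ x ]≔ false) (Y [ x ]≔ false))
    ≡⟨ x∨[y∨z]≡y∨[x∨z] (X₀ ∧ Y₀) (b ∧ c) _ ⟩
  (b ∧ c) ∨ ((X₀ ∧ Y₀) ∨ meets (X [ x ]≔ false) (Y [ x ]≔ false))
    ≡⟨ cong ((b ∧ c) ∨_) (meets-at X Y x) ⟨
  (b ∧ c) ∨ meets X Y ∎
  where
  open ≡-Reasoning
  X₀ = lookup X x
  Y₀ = lookup Y x
meets-swap (there s) (b ∷ X) (c ∷ Y) = cong ((b ∧ c) ∨_) (meets-swap s X Y)

∑-swap : (s : Transposition n) (f : Subset n → ℕ) → ∑ (λ X → f (swap s X)) ≡ ∑ f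
∑-swap (here x)  f = ∑-split-at x λ b Y → f (b ∷ Y)
∑-swap (there s) f = cong₂ _+_ (∑-swap s λ X → f (false ∷ X)) (∑-swap s λ X → f (true ∷ X))

data Kind : Set where
  source target fixed : Kind

kindOf : Bool → Bool → Kind
kindOf true  false = source
kindOf false true  = target
kindOf true  true  = fixed
kindOf false false = fixed

kind : Transposition n → Subset n → Kind
kind (here x)  (b ∷ X) = kindOf b (lookup X x)
kind (there s) (b ∷ X) = kind s X

opposite : Kind → Kind
opposite source = target
opposite target = source
opposite fixed  = fixed

kind-swap : (s : Transposition n) (X : Subset n) → kind s (swap s X) ≡ opposite (kind s X)
kind-swap (here x)  (b ∷ X) rewrite lookup∘updateAt x {const b} X = kindOf-flip b (lookup X x)
  where
  kindOf-flip : ∀ b c → kindOf c b ≡ opposite (kindOf b c)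
  kindOf-flip false false = refl
  kindOf-flip false true  = refl
  kindOf-flip true  false = refl
  kindOf-flip true  true  = refl
kind-swap (there s) (b ∷ X) = kind-swap s X

swap-fixed : (s : Transposition n) (X : Subset n) → kind s X ≡ fixed → swap s X ≡ X
swap-fixed (here x) (b ∷ X) k with lookup X x in X₀
swap-fixed (here x) (false ∷ X) k | false = cong (false ∷_) (trans (cong (X [ x ]≔_) (sym X₀)) ([]≔-lookup X x))
swap-fixed (here x) (true  ∷ X) k | true  = cong (true ∷_)  (trans (cong (X [ x ]≔_) (sym X₀)) ([]≔-lookup X x))
swap-fixed (here x) (false ∷ X) () | true
swap-fixed (here x) (true  ∷ X) () | false
swap-fixed (there s) (b ∷ X) k = cong (b ∷_) (swap-fixed s X k)

targets-meet : (s : Transposition n) (X Y : Subset n) → kind s X ≡ target → kind s Y ≡ target → meets X Y ≡ true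
targets-meet (here x) (b ∷ X) (c ∷ Y) kX kY = begin
  (b ∧ c) ∨ meets X Y                   ≡⟨ cong ((b ∧ c) ∨_) (meets-at X Y x) ⟩
  (b ∧ c) ∨ ((lookup X x ∧ lookup Y x) ∨ rest)
    ≡⟨ cong (λ z → (b ∧ c) ∨ (z ∨ rest)) (cong₂ _∧_ (second kX) (second kY)) ⟩
  (b ∧ c) ∨ true                        ≡⟨ ∨-zeroʳ (b ∧ c) ⟩
  true                                  ∎
  where
  open ≡-Reasoning
  rest = meets (X [ x ]≔ false) (Y [ x ]≔ false)
  second : ∀ {b c} → kindOf b c ≡ target → c ≡ true
  second {false} {true} _ = refl
  second {true} {false} ()
  second {true} {true} ()
  second {false} {false} ()
targets-meet (there s) (b ∷ X) (c ∷ Y) kX kY =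
  trans (cong ((b ∧ c) ∨_) (targets-meet s X Y kX kY)) (∨-zeroʳ (b ∧ c))

target? : (s : Transposition n) (X : Subset n) → kind s X ≡ target ⊎ kind s X ≢ target
target? s X with kind s X
... | source = inj₂ λ ()
... | target = inj₁ refl
... | fixed  = inj₂ λ ()

∧-true : ∀ {a b} → a ∧ b ≡ true → a ≡ true × b ≡ true
∧-true {true} {true} _ = refl , refl

∨-true : ∀ {a b} → a ∨ b ≡ true → a ≡ true ⊎ b ≡ true
∨-true {true}  _ = inj₁ refl
∨-true {false} e = inj₂ e

combine : Kind → Bool → Bool → Bool
combine source u v = u ∧ v
combine target u v = u ∨ v
combine fixed  u v = u

-- The compression along s: a source set survives only if its swap is present too, and a
-- target set is added as soon as its swap is present.
shift : Transposition n → Family n → Family n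
shift s A X = combine (kind s X) (A X) (A (swap s X))

Shifted : Family n → Set
Shifted A = ∀ s X → shift s A X ≡ A X

shift-swap : (s : Transposition n) (A : Family n) (X : Subset n) →
             shift s A (swap s X) ≡ combine (opposite (kind s X)) (A (swap s X)) (A X)
shift-swap s A X rewrite kind-swap s X | swap-involutive s X = refl

shift-member : (s : Transposition n) (A : Family n) (X : Subset n) →
               shift s A X ≡ true → A X ≡ true ⊎ A (swap s X) ≡ true
shift-member s A X X∈ with kind s X
... | source = inj₁ (proj₁ (∧-true X∈))
... | target = ∨-true X∈
... | fixed  = inj₁ X∈

shift-member-nontarget : (s : Transposition n) (A : Family n) (X : Subset n) →
                         shift s A X ≡ true → kind s X ≢ target →
                         A X ≡ true × A (swap s X) ≡ true
shift-member-nontarget s A X X∈ ≢target with kind s X in k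
... | source = ∧-true X∈
... | target = contradiction refl ≢target
... | fixed  = X∈ , trans (cong A (swap-fixed s X k)) X∈

uniform-shift : (s : Transposition n) {A : Family n} → Uniform k A → Uniform k (shift s A)
uniform-shift s {A} uA X X∈ with shift-member s A X X∈
... | inj₁ AX  = uA X AX
... | inj₂ AsX = trans (sym (∣swap∣ s X)) (uA _ AsX)

nonempty-shift : (s : Transposition n) {A : Family n} → NonEmpty A → NonEmpty (shift s A)
nonempty-shift s {A} (X , AX) with shift s A X in X∈
... | true  = X , X∈
... | false = swap s X , trans (shift-swap s A X) (rescued (kind s X) AX X∈)
  where
  rescued : ∀ t {u v} → u ≡ true → combine t u v ≡ false → combine (opposite t) v u ≡ true
  rescued source {true} {false} _ _ = refl
  rescued source {true} {true}  _ ()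
  rescued target {true}         _ ()
  rescued fixed  {true}         _ ()

cross-shift : (s : Transposition n) {A B : Family n} → CrossIntersecting A B → CrossIntersecting (shift s A) (shift s B)
cross-shift s {A} {B} cross X Y X∈ Y∈ = by-kinds (target? s X) (target? s Y)
  where
  meet : (A X ≡ true × B Y ≡ true) ⊎ (A (swap s X) ≡ true × B (swap s Y) ≡ true) → meets X Y ≡ true
  meet (inj₁ (AX , BY))   = cross X Y AX BY
  meet (inj₂ (AsX , BsY)) = trans (sym (meets-swap s X Y)) (cross _ _ AsX BsY)

  by-kinds : kind s X ≡ target ⊎ kind s X ≢ target → kind s Y ≡ target ⊎ kind s Y ≢ target → meets X Y ≡ true
  by-kinds (inj₁ tX) (inj₁ tY) = targets-meet s X Y tX tY
  by-kinds (inj₂ nX) _         =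
    let AX , AsX = shift-member-nontarget s A X X∈ nX in meet (Sum.map (AX ,_) (AsX ,_) (shift-member s B Y Y∈))
  by-kinds (inj₁ _)  (inj₂ nY) =
    let BY , BsY = shift-member-nontarget s B Y Y∈ nY in meet (Sum.map (_, BY) (_, BsY) (shift-member s A X X∈))

shift-pair : (s : Transposition n) {A B : Family n} →
             CrossIntersectingPair k A B → CrossIntersectingPair k (shift s A) (shift s B)
shift-pair s p = record
  { uniformˡ  = uniform-shift s uniformˡ
  ; uniformʳ  = uniform-shift s uniformʳ
  ; cross     = cross-shift s cross
  ; nonemptyˡ = nonempty-shift s nonemptyˡ
  ; nonemptyʳ = nonempty-shift s nonemptyʳ
  }
  where open CrossIntersectingPair p

m+m≤n+n⇒m≤n : m + m ≤ n + n → m ≤ n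
m+m≤n+n⇒m≤n m+m≤n+n = ≮⇒≥ λ n<m → <⇒≱ (+-mono-< n<m n<m) m+m≤n+n

m+m<n+n⇒m<n : m + m < n + n → m < n
m+m<n+n⇒m<n m+m<n+n = ≰⇒> λ n≤m → <⇒≱ m+m<n+n (+-mono-≤ n≤m n≤m)

module _ (s : Transposition n) where

  ∑-pairs : (f : Subset n → ℕ) → ∑ f + ∑ f ≡ ∑ (λ X → f X + f (swap s X))
  ∑-pairs f = trans (cong (∑ f +_) (sym (∑-swap s f))) (sym (∑-distrib-+ f λ X → f (swap s X)))

  ∑-mono-≤-pairs : {f g : Subset n → ℕ} → (∀ X → f X + f (swap s X) ≤ g X + g (swap s X)) → ∑ f ≤ ∑ g
  ∑-mono-≤-pairs {f} {g} le = m+m≤n+n⇒m≤n (subst₂ _≤_ (sym (∑-pairs f)) (sym (∑-pairs g)) (∑-mono-≤ le))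

  ∑-mono-<-pairs : {f g : Subset n → ℕ} → (∀ X → f X + f (swap s X) ≤ g X + g (swap s X)) →
                   ∀ X₀ → f X₀ + f (swap s X₀) < g X₀ + g (swap s X₀) → ∑ f < ∑ g
  ∑-mono-<-pairs {f} {g} le X₀ lt = m+m<n+n⇒m<n (subst₂ _<_ (sym (∑-pairs f)) (sym (∑-pairs g)) (∑-mono-< le X₀ lt))

count-shift : (s : Transposition n) (A : Family n) → count (shift s A) ≡ count A
count-shift s A = ≤-antisym (∑-mono-≤-pairs s (≤-reflexive ∘ pair)) (∑-mono-≤-pairs s (≤-reflexive ∘ sym ∘ pair))
  where
  combine-count : ∀ t u v → toℕ (combine t u v) + toℕ (combine (opposite t) v u) ≡ toℕ u + toℕ v
  combine-count source false false = refl
  combine-count source false true  = refl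
  combine-count source true  false = refl
  combine-count source true  true  = refl
  combine-count target false false = refl
  combine-count target false true  = refl
  combine-count target true  false = refl
  combine-count target true  true  = refl
  combine-count fixed  u     v     = refl
  pair : ∀ X → toℕ (shift s A X) + toℕ (shift s A (swap s X)) ≡ toℕ (A X) + toℕ (A (swap s X))
  pair X = trans (cong (λ b → toℕ (shift s A X) + toℕ b) (shift-swap s A X))
                 (combine-count (kind s X) (A X) (A (swap s X)))

weighted : Bool → ℕ → ℕ
weighted b w = if b then w else 0

weight : Subset n → ℕ
weight []              = 0
weight {suc n} (b ∷ X) = weighted b (suc n) + weight X

weight-insert : (X : Subset n) (x : Fin n) → weight (X [ x ]≔ true) ≤ n + weight X
weight-insert {suc n} (a ∷ X) zero    = +-monoʳ-≤ (suc n) (m≤n+m (weight X) _)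
weight-insert {suc n} (a ∷ X) (suc x) = begin
  w + weight (X [ x ]≔ true) ≤⟨ +-monoʳ-≤ w (weight-insert X x) ⟩
  w + (n + weight X)         ≡⟨ x+[y+z]≡y+[x+z] w n (weight X) ⟩
  n + (w + weight X)         ≤⟨ n≤1+n _ ⟩
  suc n + (w + weight X)     ∎
  where
  open ≤-Reasoning
  w = weighted a (suc n)

weight-swap : (s : Transposition n) (X : Subset n) → kind s X ≡ source → weight (swap s X) < weight X
weight-swap (here x) (b ∷ X) k with b | lookup X x in X₀
... | true  | false = s≤s (weight-insert X x)
... | true  | true  = contradiction k λ ()
... | false | false = contradiction k λ ()
... | false | true  = contradiction k λ ()
weight-swap {suc n} (there s) (b ∷ X) k = +-monoʳ-< (weighted b (suc n)) (weight-swap s X k)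

familyWeight : Family n → ℕ
familyWeight A = ∑ λ X → weighted (A X) (weight X)

module _ (s : Transposition n) (A : Family n) where

  private
    pairWeight : Family n → Subset n → ℕ
    pairWeight B X = weighted (B X) (weight X) + weighted (B (swap s X)) (weight (swap s X))

    weight-swap⁻¹ : ∀ X → kind s X ≡ target → weight X < weight (swap s X)
    weight-swap⁻¹ X k = subst (λ Y → weight Y < weight (swap s X)) (swap-involutive s X)
                              (weight-swap s (swap s X) (trans (kind-swap s X) (cong opposite k)))

    pairWeight-< : ∀ X → shift s A X ≢ A X → pairWeight (shift s A) X < pairWeight A X
    pairWeight-< X changed rewrite shift-swap s A X with kind s X in k | A X | A (swap s X)
    ... | source | true  | false = ≤-trans (weight-swap s X k) (≤-reflexive (sym (+-identityʳ _)))
    ... | target | false | true  = ≤-trans (s≤s (≤-reflexive (+-identityʳ _))) (weight-swap⁻¹ X k)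
    ... | source | true  | true  = contradiction refl changed
    ... | source | false | _     = contradiction refl changed
    ... | target | true  | _     = contradiction refl changed
    ... | target | false | false = contradiction refl changed
    ... | fixed  | _     | _     = contradiction refl changed

    pairWeight-≤ : ∀ X → pairWeight (shift s A) X ≤ pairWeight A X
    pairWeight-≤ X with shift s A X Bool.≟ A X
    ... | no changed = <⇒≤ (pairWeight-< X changed)
    ... | yes same   = ≤-reflexive (cong₂ _+_ (cong (λ b → weighted b (weight X)) same)
                                              (cong (λ b → weighted b (weight (swap s X))) (swap-same same)))
      where
      unchanged : ∀ t {u v} → combine t u v ≡ u → combine (opposite t) v u ≡ v
      unchanged source {true}  {true}  _ = refl
      unchanged source {false} {true}  _ = refl
      unchanged source {false} {false} _ = refl
      unchanged target {true}  {true}  _ = refl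
      unchanged target {true}  {false} _ = refl
      unchanged target {false} {false} _ = refl
      unchanged fixed                  _ = refl
      swap-same : shift s A X ≡ A X → shift s A (swap s X) ≡ A (swap s X)
      swap-same same = trans (shift-swap s A X) (unchanged (kind s X) same)

  familyWeight-shift-≤ : familyWeight (shift s A) ≤ familyWeight A
  familyWeight-shift-≤ = ∑-mono-≤-pairs s pairWeight-≤

  familyWeight-shift-< : ∀ X → shift s A X ≢ A X → familyWeight (shift s A) < familyWeight A
  familyWeight-shift-< X changed = ∑-mono-<-pairs s pairWeight-≤ X (pairWeight-< X changed)

any-transposition? : {P : Transposition n → Set} → (∀ s → Dec (P s)) → Dec (∃ P)
any-transposition? {zero}  P? = no λ ()
any-transposition? {suc n} P? =
  map′ [ (λ (x , p) → here x , p) , (λ (s , p) → there s , p) ]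
       (λ { (here x , p) → inj₁ (x , p) ; (there s , p) → inj₂ (s , p) })
       (any? (P? ∘ here) ⊎-dec any-transposition? (P? ∘ there))

shifted-or-shiftable : (A : Family n) → Shifted A ⊎ ∃₂ λ s X → shift s A X ≢ A X
shifted-or-shiftable A with any-transposition? (λ s → anySubset? λ X → ¬? (shift s A X Bool.≟ A X))
... | yes (s , X , changed) = inj₂ (s , X , changed)
... | no none = inj₁ λ s X → decidable-stable (shift s A X Bool.≟ A X) λ changed → none (s , X , changed)

shifting-induction : ∀ {ℓ} (P : Family n → Family n → Set ℓ) →
                     (∀ s {A B} → P (shift s A) (shift s B) → P A B) →
                     (∀ {A B} → Shifted A → Shifted B → P A B) →
                     ∀ A B → P A B
shifting-induction P step shifted A B = All.wfRec wf _ (uncurry P) go (A , B)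
  where
  measure : Family _ × Family _ → ℕ
  measure (A , B) = familyWeight A + familyWeight B
  wf = On.wellFounded measure <-wellFounded
  go : ∀ AB → WfRec (_<_ on measure) (uncurry P) AB → uncurry P AB
  go (A , B) rec with shifted-or-shiftable A | shifted-or-shiftable B
  ... | inj₁ shA | inj₁ shB = shifted shA shB
  ... | inj₂ (s , X , changed) | _ =
    step s (rec (+-mono-<-≤ (familyWeight-shift-< s A X changed) (familyWeight-shift-≤ s B)))
  ... | inj₁ _ | inj₂ (s , Y , changed) =
    step s (rec (+-mono-≤-< (familyWeight-shift-≤ s A) (familyWeight-shift-< s B Y changed)))

-- The Hilton–Milner bound

deletion link : Family (suc n) → Family n
deletion A X = A (false ∷ X)
link     A X = A (true ∷ X)

shifted-deletion : {A : Family (suc n)} → Shifted A → Shifted (deletion A)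
shifted-deletion shA s X = shA (there s) (false ∷ X)

shifted-link : {A : Family (suc n)} → Shifted A → Shifted (link A)
shifted-link shA s X = shA (there s) (true ∷ X)

shifted-move-first : {A : Family (suc n)} → Shifted A → (X : Subset n) (x : Fin n) →
                A (true ∷ X) ≡ true → lookup X x ≡ false → A (false ∷ X [ x ]≔ true) ≡ true
shifted-move-first {A = A} shA X x A1X Xx = begin
  A (false ∷ Y)                                ≡⟨ shA (here x) (false ∷ Y) ⟨
  shift (here x) A (false ∷ Y)
    ≡⟨ cong (λ b → combine (kindOf false b) (A (false ∷ Y)) (A (b ∷ Y [ x ]≔ false))) (lookup∘updateAt x X) ⟩
  A (false ∷ Y) ∨ A (true ∷ Y [ x ]≔ false)    ≡⟨ cong (λ Z → A (false ∷ Y) ∨ A (true ∷ Z)) Y[x]≔false ⟩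
  A (false ∷ Y) ∨ A (true ∷ X)                 ≡⟨ cong (A (false ∷ Y) ∨_) A1X ⟩
  A (false ∷ Y) ∨ true                         ≡⟨ ∨-zeroʳ _ ⟩
  true                                         ∎
  where
  open ≡-Reasoning
  Y = X [ x ]≔ true
  Y[x]≔false : Y [ x ]≔ false ≡ X
  Y[x]≔false = trans ([]≔-idempotent X x) (trans (cong (X [ x ]≔_) (sym Xx)) ([]≔-lookup X x))

nonempty-deletion : {A : Family (suc n)} → Shifted A → Uniform k A → k ≤ n → NonEmpty A → NonEmpty (deletion A)
nonempty-deletion shA uA k≤n (false ∷ X , AX) = X , AX
nonempty-deletion shA uA k≤n (true  ∷ X , AX) =
  let x , Xx = free-coordinate X (subst (_≤ _) (sym (uA _ AX)) k≤n) in X [ x ]≔ true , shifted-move-first shA X x AX Xx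

-- If X and Y were disjoint, shifting would move the first element of true ∷ Y to a coordinate
-- missed by both, giving a member of B disjoint from true ∷ X.
cross-link : {A B : Family (suc n)} → Shifted B → Uniform k (link A) → Uniform k (link B) → k + k < n →
             CrossIntersecting A B → CrossIntersecting (link A) (link B)
cross-link {n} shB uA uB 2k<n cross X Y AX BY with meets X Y in XY
... | true  = refl
... | false =
  let x , Xx , Yx = common-free-coordinate X Y XY (subst₂ (λ a b → a + b < n) (sym (uA X AX)) (sym (uB Y BY)) 2k<n)
  in  contradiction (trans (sym (cross _ _ AX (shifted-move-first shB Y x BY Yx))) (trans (meets-insert X Y x Xx) XY)) λ ()

deletion-pair : {A B : Family (suc n)} → Shifted A → Shifted B → k ≤ n →
                CrossIntersectingPair k A B → CrossIntersectingPair k (deletion A) (deletion B)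
deletion-pair shA shB k≤n p = record
  { uniformˡ  = λ X → uniformˡ (false ∷ X)
  ; uniformʳ  = λ Y → uniformʳ (false ∷ Y)
  ; cross     = λ X Y → cross (false ∷ X) (false ∷ Y)
  ; nonemptyˡ = nonempty-deletion shA uniformˡ k≤n nonemptyˡ
  ; nonemptyʳ = nonempty-deletion shB uniformʳ k≤n nonemptyʳ
  }
  where open CrossIntersectingPair p

link-pair : {A B : Family (suc n)} → Shifted B → k + k < n → CrossIntersectingPair (suc k) A B →
            NonEmpty (link A) → NonEmpty (link B) → CrossIntersectingPair k (link A) (link B)
link-pair {A = A} {B} shB 2k<n p neA neB = record
  { uniformˡ = uA ; uniformʳ = uB ; cross = cross-link shB uA uB 2k<n cross ; nonemptyˡ = neA ; nonemptyʳ = neB }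
  where
  open CrossIntersectingPair p
  uA : Uniform _ (link A)
  uA X AX = suc-injective (uniformˡ (true ∷ X) AX)
  uB : Uniform _ (link B)
  uB Y BY = suc-injective (uniformʳ (true ∷ Y) BY)

hilton-milner-2k≡n : {A B : Family n} → k + k ≡ n → CrossIntersectingPair k A B → HiltonMilnerBound k A B
hilton-milner-2k≡n {n} {k} {A} {B} 2k≡n p = begin
  count A + count B + (n ∸ k) C k ≡⟨ cong (λ z → count A + count B + z C k) n∸k≡k ⟩
  count A + count B + k C k       ≡⟨ cong (count A + count B +_) (nCn≡1 k) ⟩
  count A + count B + 1           ≤⟨ +-monoˡ-≤ 1 (complement-bound 2k≡n uniformˡ uniformʳ cross) ⟩
  n C k + 1                       ∎
  where
  open ≤-Reasoning
  open CrossIntersectingPair p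
  n∸k≡k = trans (cong (_∸ k) (sym 2k≡n)) (m+n∸n≡m k k)

link-bound-meeting : {A B : Family (suc m)} → CrossIntersectingPair (suc k) A B → NonEmpty (deletion A) →
                     count (link B) + (m ∸ suc k) C k ≤ m C k
link-bound-meeting {m} {k} {A} {B} p (Z , AZ) =
  subst (λ z → count (link B) + (m ∸ z) C k ≤ m C k) (uniformˡ (false ∷ Z) AZ)
        (meeting-bound Z λ Y BY → cross (false ∷ Z) (true ∷ Y) AZ BY , suc-injective (uniformʳ (true ∷ Y) BY))
  where open CrossIntersectingPair p

link-bound-nonempty : {A B : Family m} → suc k + suc k ≤ m → CrossIntersectingPair k A B → HiltonMilnerBound k A B →
                      count A + count B + (m ∸ suc k) C k ≤ m C k
link-bound-nonempty {k = zero} _ p _ = contradiction p no-pair-of-0-sets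
link-bound-nonempty {m} {suc j} {A} {B} 2k≤m _ bound = s≤s⁻¹ (begin
  suc (count A + count B + t C suc j)    ≡⟨ +-suc (count A + count B) _ ⟨
  count A + count B + suc (t C suc j)    ≤⟨ +-monoʳ-≤ (count A + count B) (+-monoˡ-≤ (t C suc j) (0<nCk j≤t)) ⟩
  count A + count B + (t C j + t C suc j) ≡⟨ cong (count A + count B +_) (nCk+nC[k+1]≡[n+1]C[k+1] t j) ⟩
  count A + count B + suc t C suc j       ≡⟨ cong (λ z → count A + count B + z C suc j) (+-∸-assoc 1 k≤m) ⟨
  count A + count B + (m ∸ suc j) C suc j ≤⟨ bound ⟩
  m C suc j + 1                           ≡⟨ +-comm (m C suc j) 1 ⟩
  suc (m C suc j)                         ∎)
  where
  open ≤-Reasoning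
  t = m ∸ suc (suc j)
  k≤m : suc (suc j) ≤ m
  k≤m = ≤-trans (m≤m+n (suc (suc j)) _) 2k≤m
  j≤t : j ≤ t
  j≤t = m+n≤o⇒m≤o∸n j (≤-trans (n≤1+n _) (≤-trans (n≤1+n _) 2k≤m))

link-bound : {A B : Family (suc m)} → Shifted A → Shifted B → suc k + suc k ≤ m → CrossIntersectingPair (suc k) A B →
             (CrossIntersectingPair k (link A) (link B) → HiltonMilnerBound k (link A) (link B)) →
             count (link A) + count (link B) + (m ∸ suc k) C k ≤ m C k
link-bound {m} {k} {A} {B} shA shB 2k≤m p bound = by-cases (nonempty? (link A)) (nonempty? (link B))
  where
  p₀ = deletion-pair shA shB (≤-trans (m≤m+n (suc k) _) 2k≤m) p
  open CrossIntersectingPair p₀ using () renaming (nonemptyˡ to ne₀A; nonemptyʳ to ne₀B)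

  by-cases : Dec (NonEmpty (link A)) → Dec (NonEmpty (link B)) →
             count (link A) + count (link B) + (m ∸ suc k) C k ≤ m C k
  by-cases (no emptyA) _ =
    subst (λ c → c + count (link B) + (m ∸ suc k) C k ≤ m C k) (sym (count-empty (link A) emptyA))
          (link-bound-meeting p ne₀A)
  by-cases (yes _) (no emptyB) =
    subst (λ c → count (link A) + c + (m ∸ suc k) C k ≤ m C k) (sym (count-empty (link B) emptyB))
          (subst (λ c → c + (m ∸ suc k) C k ≤ m C k) (sym (+-identityʳ (count (link A))))
                 (link-bound-meeting (pair-sym p) ne₀B))
  by-cases (yes neA) (yes neB) = link-bound-nonempty 2k≤m q (bound q)
    where q = link-pair shB (≤-trans (s≤s (+-monoʳ-≤ k (n≤1+n k))) 2k≤m) p neA neB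

hilton-milner-split : {A B : Family (suc m)} → suc k ≤ m →
                      HiltonMilnerBound (suc k) (deletion A) (deletion B) →
                      count (link A) + count (link B) + (m ∸ suc k) C k ≤ m C k →
                      HiltonMilnerBound (suc k) A B
hilton-milner-split {m} {k} {A} {B} k<m deletion-bound link-bound = begin
  (a₀ + a₁) + (b₀ + b₁) + (m ∸ k) C suc k     ≡⟨ cong (λ z → (a₀ + a₁) + (b₀ + b₁) + z C suc k) (+-∸-assoc 1 k<m) ⟩
  (a₀ + a₁) + (b₀ + b₁) + suc t C suc k       ≡⟨ cong ((a₀ + a₁) + (b₀ + b₁) +_) (nCk+nC[k+1]≡[n+1]C[k+1] t k) ⟨
  (a₀ + a₁) + (b₀ + b₁) + (t C k + t C suc k) ≡⟨ regroup a₀ a₁ b₀ b₁ (t C k) (t C suc k) ⟩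
  (a₀ + b₀ + t C suc k) + (a₁ + b₁ + t C k)   ≤⟨ +-mono-≤ deletion-bound link-bound ⟩
  (m C suc k + 1) + m C k                     ≡⟨ regroup′ (m C suc k) (m C k) ⟩
  (m C k + m C suc k) + 1                     ≡⟨ cong (_+ 1) (nCk+nC[k+1]≡[n+1]C[k+1] m k) ⟩
  suc m C suc k + 1                           ∎
  where
  open ≤-Reasoning
  a₀ = count (deletion A)
  a₁ = count (link A)
  b₀ = count (deletion B)
  b₁ = count (link B)
  t = m ∸ suc k
  regroup : ∀ a₀ a₁ b₀ b₁ x y → (a₀ + a₁) + (b₀ + b₁) + (x + y) ≡ (a₀ + b₀ + y) + (a₁ + b₁ + x)
  regroup = solve-∀
  regroup′ : ∀ x y → (x + 1) + y ≡ (y + x) + 1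
  regroup′ = solve-∀

hilton-milner-shifted : ∀ n k → k + k ≤ n → {A B : Family n} → Shifted A → Shifted B →
                        CrossIntersectingPair k A B → HiltonMilnerBound k A B
hilton-milner-shifted n zero _ _ _ p = contradiction p no-pair-of-0-sets
hilton-milner-shifted n (suc k) 2k≤n shA shB p with m≤n⇒m<n∨m≡n 2k≤n
... | inj₂ 2k≡n = hilton-milner-2k≡n 2k≡n p
hilton-milner-shifted (suc m) (suc k) _ {A} {B} shA shB p | inj₁ (s≤s 2k≤m) =
  hilton-milner-split {A = A} {B} k<m
    (hilton-milner-shifted m (suc k) 2k≤m (shifted-deletion shA) (shifted-deletion shB) (deletion-pair shA shB k<m p))
    (link-bound shA shB 2k≤m p (hilton-milner-shifted m k (≤-trans (+-mono-≤ (n≤1+n k) (n≤1+n k)) 2k≤m)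
                                                      (shifted-link shA) (shifted-link shB)))
  where k<m = ≤-trans (m≤m+n (suc k) _) 2k≤m

hilton-milner : k + k ≤ n → (A B : Family n) → CrossIntersectingPair k A B → HiltonMilnerBound k A B
hilton-milner {k} {n} 2k≤n = shifting-induction P step λ shA shB → hilton-milner-shifted n k 2k≤n shA shB
  where
  P : Family n → Family n → Set
  P A B = CrossIntersectingPair k A B → HiltonMilnerBound k A B
  step : ∀ s {A B} → P (shift s A) (shift s B) → P A B
  step s {A} {B} bound p =
    subst₂ (λ a b → a + b + (n ∸ k) C k ≤ n C k + 1) (count-shift s A) (count-shift s B) (bound (shift-pair s p))

_≟ₛ_ : DecidableEquality (Subset n)
_≟ₛ_ = ≡-dec Bool._≟_

count-singleton : (X₀ : Subset n) → count (λ X → does (X₀ ≟ₛ X)) ≡ 1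
count-singleton []                   = refl
count-singleton {suc n} (false ∷ X₀) = cong₂ _+_ (count-singleton X₀) (∑-zero {n} λ _ → refl)
count-singleton {suc n} (true  ∷ X₀) = cong₂ _+_ (∑-zero {n} λ _ → refl) (count-singleton X₀)

count-without : {A : Family n} (X₀ : Subset n) → A X₀ ≡ true →
                count A ≡ suc (count λ X → A X ∧ not (does (X₀ ≟ₛ X)))
count-without {A = A} X₀ AX₀ = begin
  count A                                ≡⟨ ∑-cong pointwise ⟩
  ∑ (λ X → toℕ (is-X₀ X) + toℕ (rest X)) ≡⟨ ∑-distrib-+ (toℕ ∘ is-X₀) (toℕ ∘ rest) ⟩
  count is-X₀ + count rest               ≡⟨ cong (_+ count rest) (count-singleton X₀) ⟩
  suc (count rest)                       ∎
  where
  open ≡-Reasoning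
  is-X₀ : Family _
  is-X₀ X = does (X₀ ≟ₛ X)
  rest : Family _
  rest X = A X ∧ not (is-X₀ X)
  pointwise : ∀ X → toℕ (A X) ≡ toℕ (is-X₀ X) + toℕ (rest X)
  pointwise X with X₀ ≟ₛ X
  ... | yes refl = trans (cong toℕ AX₀) (cong (suc ∘ toℕ) (sym (∧-zeroʳ (A X))))
  ... | no  _    = cong toℕ (sym (∧-identityʳ (A X)))

injective-≤-count : {A : Family n} (T : Fin k → Subset n) → Injective _≡_ _≡_ T →
                    (∀ i → A (T i) ≡ true) → k ≤ count A
injective-≤-count {k = zero}  _ _ _ = z≤n
injective-≤-count {k = suc k} {A} T T-inj T∈A =
  subst (suc k ≤_) (sym (count-without (T zero) (T∈A zero)))
        (s≤s (injective-≤-count (T ∘ suc) (Fin.suc-injective ∘ T-inj) T∈A′))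
  where
  T∈A′ : ∀ i → A (T (suc i)) ∧ not (does (T zero ≟ₛ T (suc i))) ≡ true
  T∈A′ i with T zero ≟ₛ T (suc i)
  ... | yes T₀≡Tᵢ = contradiction (T-inj T₀≡Tᵢ) λ ()
  ... | no  _     = trans (∧-identityʳ _) (T∈A (suc i))

image : (Fin k → Subset n) → Family n
image T X = does (any? λ i → T i ≟ₛ X)

image-∋ : (T : Fin k → Subset n) (i : Fin k) → image T (T i) ≡ true
image-∋ T i = dec-true (any? λ j → T j ≟ₛ T i) (i , refl)

image-∀ : (T : Fin k → Subset n) (Q : Subset n → Set) → (∀ i → Q (T i)) → ∀ {X} → image T X ≡ true → Q X
image-∀ T Q Q-T {X} X∈ with any? (λ i → T i ≟ₛ X)
... | yes (i , refl) = Q-T i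

_>>=_ : ∀ {a b} {A : Set a} {B : Set b} → ¬ ¬ A → (A → ¬ ¬ B) → ¬ ¬ B
¬¬a >>= f = negated-stable (¬¬-map f ¬¬a)

return : ∀ {a} {A : Set a} → A → ¬ ¬ A
return a ¬a = ¬a a

¬¬-choice : ∀ {b} d {B : Fin d → Set b} → (∀ i → ¬ ¬ B i) → ¬ ¬ (∀ i → B i)
¬¬-choice zero    _   = return λ ()
¬¬-choice (suc d) ¬¬B = do
  B₀ ← ¬¬B zero
  Bₛ ← ¬¬-choice d (¬¬B ∘ suc)
  return λ { zero → B₀ ; (suc i) → Bₛ i }

_<ˡ_ : Subset n → Subset n → Set
_<ˡ_ = Lex-< _≡_ Bool._<_

<ˡ-trans : {X Y Z : Subset n} → X <ˡ Y → Y <ˡ Z → X <ˡ Z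
<ˡ-trans = Lex.<-trans (IsEquivalence.isPartialEquivalence isEquivalence) Bool.<-resp₂-≡ Bool.<-trans

<ˡ-irrefl : {X : Subset n} → ¬ X <ˡ X
<ˡ-irrefl = Lex.<-irrefl Bool.<-irrefl (≡⇒Pointwise-≡ refl)

_≤ˡ_ : Subset n → Subset n → Set
X ≤ˡ Y = X <ˡ Y ⊎ X ≡ Y

≤ˡ-<ˡ-trans : {X Y Z : Subset n} → X ≤ˡ Y → Y <ˡ Z → X <ˡ Z
≤ˡ-<ˡ-trans (inj₁ X<Y)  Y<Z = <ˡ-trans X<Y Y<Z
≤ˡ-<ˡ-trans (inj₂ refl) Y<Z = Y<Z

<ˡ-cmp : Trichotomous _≡_ (_<ˡ_ {n})
<ˡ-cmp X Y with Lex.<-cmp sym Bool.<-cmp X Y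
... | tri< X<Y X≢Y X≯Y = tri< X<Y (X≢Y ∘ ≡⇒Pointwise-≡) X≯Y
... | tri≈ X≮Y X≡Y X≯Y = tri≈ X≮Y (Pointwise-≡⇒≡ X≡Y) X≯Y
... | tri> X≮Y X≢Y X>Y = tri> X≮Y (X≢Y ∘ ≡⇒Pointwise-≡) X>Y

argmax : (L : Fin (suc d) → Subset n) → ∃ λ i → ∀ j → L j ≤ˡ L i
argmax {zero}  L = zero , λ { zero → inj₂ refl }
argmax {suc d} L with argmax (L ∘ suc)
... | i , L≤Lᵢ with <ˡ-cmp (L zero) (L (suc i))
...   | tri< L₀<Lᵢ _ _ = suc i , λ { zero → inj₁ L₀<Lᵢ ; (suc j) → L≤Lᵢ j }
...   | tri≈ _ L₀≡Lᵢ _ = suc i , λ { zero → inj₂ L₀≡Lᵢ ; (suc j) → L≤Lᵢ j }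
...   | tri> _ _ Lᵢ<L₀ = zero  , λ { zero → inj₂ refl ; (suc j) → inj₁ (≤ˡ-<ˡ-trans (L≤Lᵢ j) Lᵢ<L₀) }

split-∷ : ∀ a b s (A B S : Subset n) → isSplit (a ∷ A) (b ∷ B) (s ∷ S) ≡ true →
          b ≡ s ∧ not a × isSplit A B S ≡ true
split-∷ false false false _ _ _ split = refl , split
split-∷ true  false true  _ _ _ split = refl , split
split-∷ false true  true  _ _ _ split = refl , split
split-∷ false false true  _ _ _ ()
split-∷ false true  false _ _ _ ()
split-∷ true  false false _ _ _ ()
split-∷ true  true  _     _ _ _ ()

split-unique : (A B B′ S : Subset n) → isSplit A B S ≡ true → isSplit A B′ S ≡ true → B ≡ B′
split-unique []      []      []        []      _     _      = refl
split-unique (a ∷ A) (b ∷ B) (b′ ∷ B′) (s ∷ S) split split′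
  with split-∷ a b s A B S split | split-∷ a b′ s A B′ S split′
... | b≡ , tail | b′≡ , tail′ = cong₂ _∷_ (trans b≡ (sym b′≡)) (split-unique A B B′ S tail tail′)

split-antitone : (A B A′ B′ S : Subset n) → isSplit A B S ≡ true → isSplit A′ B′ S ≡ true → A′ <ˡ A → B <ˡ B′
split-antitone [] [] [] [] [] _ _ (base ())
split-antitone (true ∷ A) (false ∷ B) (false ∷ A′) (b′ ∷ B′) (true ∷ S) split split′ (this Bool.f<t refl) =
  this (subst (false Bool.<_) (sym (proj₁ (split-∷ false b′ true A′ B′ S split′))) Bool.f<t) refl
split-antitone (true ∷ A) (true ∷ B) (false ∷ A′) _ (_ ∷ S) () _ (this Bool.f<t refl)
split-antitone (true ∷ A) (false ∷ B) (false ∷ A′) _ (false ∷ S) () _ (this Bool.f<t refl)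
split-antitone (a ∷ A) (b ∷ B) (.a ∷ A′) (b′ ∷ B′) (s ∷ S) split split′ (next refl A′<A)
  with split-∷ a b s A B S split | split-∷ a b′ s A′ B′ S split′
... | b≡ , tail | b′≡ , tail′ = next (trans b≡ (sym b′≡)) (split-antitone A B A′ B′ S tail tail′ A′<A)

split-∪ : (A B : Subset n) → meets A B ≡ false → isSplit A B (A ∪ B) ≡ true
split-∪ []          []          _ = refl
split-∪ (false ∷ A) (false ∷ B) A∩B = split-∪ A B A∩B
split-∪ (false ∷ A) (true  ∷ B) A∩B = split-∪ A B A∩B
split-∪ (true  ∷ A) (false ∷ B) A∩B = split-∪ A B A∩B
split-∪ (true  ∷ A) (true  ∷ B) ()

-- Leading subsets and the wedge product

module _ {c ℓ} (F : Field c ℓ) where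
  private module 𝔽 = Field F
  open 𝔽 using (Carrier; _≈_; 0#; 1#) renaming (_+_ to _⊕_; _*_ to _⊛_)
  open import Relation.Binary.Reasoning.Setoid 𝔽.setoid

  x*y≈0⇒y≈0 : ∀ {x y} → ¬ x ≈ 0# → x ⊛ y ≈ 0# → y ≈ 0#
  x*y≈0⇒y≈0 {x} {y} x≉0 xy≈0 = begin
    y              ≈⟨ 𝔽.*-identityˡ y ⟨
    1# ⊛ y         ≈⟨ 𝔽.*-congʳ x⁻¹x≈1 ⟨
    (x⁻¹ ⊛ x) ⊛ y  ≈⟨ 𝔽.*-assoc x⁻¹ x y ⟩
    x⁻¹ ⊛ (x ⊛ y)  ≈⟨ 𝔽.*-congˡ xy≈0 ⟩
    x⁻¹ ⊛ 0#       ≈⟨ 𝔽.zeroʳ x⁻¹ ⟩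
    0#             ∎
    where
    x⁻¹ = proj₁ (𝔽.inverse x x≉0)
    x⁻¹x≈1 = 𝔽.trans (𝔽.*-comm x⁻¹ x) (proj₂ (𝔽.inverse x x≉0))

  *-nonzero : ∀ {x y} → ¬ x ≈ 0# → ¬ y ≈ 0# → ¬ x ⊛ y ≈ 0#
  *-nonzero x≉0 y≉0 xy≈0 = y≉0 (x*y≈0⇒y≈0 x≉0 xy≈0)

  Leading : (Subset m → Carrier) → Subset m → Set ℓ
  Leading x T = ¬ x T ≈ 0# × (∀ T′ → T <ˡ T′ → x T′ ≈ 0#)

  leading-subset : (x : Subset m → Carrier) → ¬ (∀ T → x T ≈ 0#) → ¬ ¬ ∃ (Leading x)
  leading-subset {zero}  x x≉0 = return ([] , (λ x[]≈0 → x≉0 λ { [] → x[]≈0 }) , λ { [] (base ()) })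
  leading-subset {suc m} x x≉0 = ¬¬-excluded-middle >>= λ where
    (no upper≉0) → do
      T , xT≉0 , above ← leading-subset (λ T → x (true ∷ T)) upper≉0
      return (true ∷ T , xT≉0 , λ { (true ∷ T′) (next refl T<T′) → above T′ T<T′ })
    (yes upper≈0) → do
      T , xT≉0 , above ← leading-subset (λ T → x (false ∷ T)) λ lower≈0 →
                           x≉0 λ { (false ∷ T) → lower≈0 T ; (true ∷ T) → upper≈0 T }
      return (false ∷ T , xT≉0 , λ { (true ∷ T′) (this Bool.f<t refl) → upper≈0 T′
                                    ; (false ∷ T′) (next refl T<T′) → above T′ T<T′ })

  -- Exterior.sumList, for subsets of any size
  sumₗ : List (Subset m) → (Subset m → Carrier) → Carrier
  sumₗ Xs f = foldr (λ X acc → f X ⊕ acc) 0# Xs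

  sumₗ-++ : (Xs Ys : List (Subset m)) (f : Subset m → Carrier) → sumₗ (Xs ++ Ys) f ≈ sumₗ Xs f ⊕ sumₗ Ys f
  sumₗ-++ []       Ys f = 𝔽.sym (𝔽.+-identityˡ _)
  sumₗ-++ (X ∷ Xs) Ys f = 𝔽.trans (𝔽.+-congˡ (sumₗ-++ Xs Ys f)) (𝔽.sym (𝔽.+-assoc _ _ _))

  sumₗ-map : (h : Subset m → Subset n) (Xs : List (Subset m)) (f : Subset n → Carrier) →
             sumₗ (map h Xs) f ≡ sumₗ Xs (f ∘ h)
  sumₗ-map h []       f = refl
  sumₗ-map h (X ∷ Xs) f = cong (f (h X) ⊕_) (sumₗ-map h Xs f)

  sumₗ-zero : (Xs : List (Subset m)) {f : Subset m → Carrier} → (∀ X → f X ≈ 0#) → sumₗ Xs f ≈ 0#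
  sumₗ-zero []       f≈0 = 𝔽.refl
  sumₗ-zero (X ∷ Xs) f≈0 = 𝔽.trans (𝔽.+-cong (f≈0 X) (sumₗ-zero Xs f≈0)) (𝔽.+-identityʳ 0#)

  sumₗ-single : (f : Subset m → Carrier) (A : Subset m) → (∀ A′ → A′ ≢ A → f A′ ≈ 0#) → sumₗ (allSubsets m) f ≈ f A
  sumₗ-single {zero}  f [] _ = 𝔽.+-identityʳ (f [])
  sumₗ-single {suc m} f (a ∷ A) f≈0 = begin
    sumₗ (map (false ∷_) all ++ map (true ∷_) all) f          ≈⟨ sumₗ-++ (map (false ∷_) all) _ f ⟩
    sumₗ (map (false ∷_) all) f ⊕ sumₗ (map (true ∷_) all) f
      ≡⟨ cong₂ _⊕_ (sumₗ-map (false ∷_) all f) (sumₗ-map (true ∷_) all f) ⟩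
    sumₗ all (f ∘ (false ∷_)) ⊕ sumₗ all (f ∘ (true ∷_))      ≈⟨ halves a f≈0 ⟩
    f (a ∷ A)                                                 ∎
    where
    all = allSubsets m
    at : ∀ b → (∀ A′ → A′ ≢ b ∷ A → f A′ ≈ 0#) → sumₗ all (f ∘ (b ∷_)) ≈ f (b ∷ A)
    at b f≈0 = sumₗ-single (f ∘ (b ∷_)) A λ A′ A′≢A → f≈0 (b ∷ A′) (A′≢A ∘ cong Data.Vec.tail)
    off : ∀ b → (∀ A′ → A′ ≢ not b ∷ A → f A′ ≈ 0#) → sumₗ all (f ∘ (b ∷_)) ≈ 0#
    off b f≈0 = sumₗ-zero all λ A′ → f≈0 (b ∷ A′) (b≢not-b ∘ cong Data.Vec.head)
      where b≢not-b = not-¬ refl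
    halves : ∀ a → (∀ A′ → A′ ≢ a ∷ A → f A′ ≈ 0#) →
             sumₗ all (f ∘ (false ∷_)) ⊕ sumₗ all (f ∘ (true ∷_)) ≈ f (a ∷ A)
    halves false f≈0 = 𝔽.trans (𝔽.+-cong (at false f≈0) (off true f≈0)) (𝔽.+-identityʳ _)
    halves true  f≈0 = 𝔽.trans (𝔽.+-cong (off false f≈0) (at true f≈0)) (𝔽.+-identityˡ _)

module _ {c ℓ} (F : Field c ℓ) (n : ℕ) where
  private module 𝔽 = Field F
  open 𝔽 using (Carrier; _≈_; 0#; 1#) renaming (_+_ to _⊕_; _*_ to _⊛_; -_ to ⊝_)
  open Exterior F n renaming (_∧_ to _⋀_)
  open import Algebra.Properties.Ring 𝔽.ring using (-‿distribˡ-*; -‿injective; -0#≈0#)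
  open import Algebra.Properties.Semiring.Sum 𝔽.semiring
    using (sum; sum-remove; *-distribʳ-sum; sum-cong-≋; sum-replicate-zero)
    renaming (∑-distrib-+ to sum-distrib-+)
  open import Relation.Binary.Reasoning.Setoid 𝔽.setoid

  signPow-nonzero : ∀ k → ¬ signPow k ≈ 0#
  signPow-nonzero zero    = 𝔽.1≉0
  signPow-nonzero (suc k) -s≈0 = signPow-nonzero k (-‿injective (𝔽.trans -s≈0 (𝔽.sym -0#≈0#)))

  wedge-at-union : ∀ {x y A B} → Leading F x A → Leading F y B → meets A B ≡ false →
                   (x ⋀ y) (A ∪ B) ≈ signPow (inversions A B) ⊛ (x A ⊛ y B)
  wedge-at-union {x} {y} {A} {B} (_ , x-above) (_ , y-above) A∩B = 𝔽.trans outer inner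
    where
    S = A ∪ B
    term : Subset n → Subset n → Carrier
    term A′ B′ = if isSplit A′ B′ S then signPow (inversions A′ B′) ⊛ (x A′ ⊛ y B′) else 0#
    split : isSplit A B S ≡ true
    split = split-∪ A B A∩B
    term≈0 : ∀ A′ B′ → (isSplit A′ B′ S ≡ true → x A′ ≈ 0# ⊎ y B′ ≈ 0#) → term A′ B′ ≈ 0#
    term≈0 A′ B′ factor≈0 with isSplit A′ B′ S in split′
    ... | false = 𝔽.refl
    ... | true with factor≈0 refl
    ...   | inj₁ xA′≈0 = 𝔽.trans (𝔽.*-congˡ (𝔽.trans (𝔽.*-congʳ xA′≈0) (𝔽.zeroˡ _))) (𝔽.zeroʳ _)
    ...   | inj₂ yB′≈0 = 𝔽.trans (𝔽.*-congˡ (𝔽.trans (𝔽.*-congˡ yB′≈0) (𝔽.zeroʳ _))) (𝔽.zeroʳ _)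
    other-factor≈0 : ∀ A′ B′ → A′ ≢ A → isSplit A′ B′ S ≡ true → x A′ ≈ 0# ⊎ y B′ ≈ 0#
    other-factor≈0 A′ B′ A′≢A split′ with <ˡ-cmp A′ A
    ... | tri< A′<A _ _ = inj₂ (y-above B′ (split-antitone A B A′ B′ S split split′ A′<A))
    ... | tri≈ _ A′≡A _ = contradiction A′≡A A′≢A
    ... | tri> _ _ A<A′ = inj₁ (x-above A′ A<A′)
    outer : (x ⋀ y) S ≈ sumList (allSubsets n) (term A)
    outer = sumₗ-single F (λ A′ → sumList (allSubsets n) (term A′)) A λ A′ A′≢A →
              sumₗ-zero F (allSubsets n) λ B′ → term≈0 A′ B′ (other-factor≈0 A′ B′ A′≢A)
    inner : sumList (allSubsets n) (term A) ≈ signPow (inversions A B) ⊛ (x A ⊛ y B)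
    inner = 𝔽.trans (sumₗ-single F (term A) B λ B′ B′≢B →
                       term≈0 A B′ λ split′ → contradiction (split-unique A B B′ S split split′) (B′≢B ∘ sym))
                    (𝔽.reflexive (cong (λ b → if b then signPow (inversions A B) ⊛ (x A ⊛ y B) else 0#) split))

  leading-meet : ∀ {x y A B} → Leading F x A → Leading F y B → (x ⋀ y) ≈ᵥ 0ᵥ → meets A B ≡ true
  leading-meet {x} {y} {A} {B} x-lead y-lead xy≈0 with meets A B in A∩B
  ... | true  = refl
  ... | false = contradiction (𝔽.trans (𝔽.sym (wedge-at-union x-lead y-lead A∩B)) (xy≈0 (A ∪ B)))
                  (*-nonzero F (signPow-nonzero (inversions A B)) (*-nonzero F (proj₁ x-lead) (proj₁ y-lead)))

  -- Gaussian elimination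

  Independent : (Fin d → MV) → Set (c ⊔ ℓ)
  Independent v = ∀ a → linComb a v ≈ᵥ 0ᵥ → ∀ i → a i ≈ 0#

  linComb-sum : (a : Fin d → Carrier) (v : Fin d → MV) (T : Subset n) → linComb a v T ≡ sum (λ i → a i ⊛ v i T)
  linComb-sum {zero}  a v T = refl
  linComb-sum {suc d} a v T = cong (a zero ⊛ v zero T ⊕_) (linComb-sum (a ∘ suc) (v ∘ suc) T)

  linComb-insertAt : (α : Fin d → Carrier) (i : Fin (suc d)) (γ : Carrier) (v : Fin (suc d) → MV) (T : Subset n) →
                     linComb (insertAt α i γ) v T ≈ γ ⊛ v i T ⊕ linComb α (removeAt v i) T
  linComb-insertAt α i γ v T = begin
    linComb (insertAt α i γ) v T                                      ≡⟨ linComb-sum (insertAt α i γ) v T ⟩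
    sum (λ j → insertAt α i γ j ⊛ v j T)                              ≈⟨ sum-remove {i = i} (λ j → insertAt α i γ j ⊛ v j T) ⟩
    insertAt α i γ i ⊛ v i T ⊕ sum (λ j → insertAt α i γ (punchIn i j) ⊛ v (punchIn i j) T)
      ≈⟨ 𝔽.+-cong (𝔽.*-congʳ (𝔽.reflexive (insertAt-lookup α i γ)))
                  (sum-cong-≋ λ j → 𝔽.*-congʳ (𝔽.reflexive (insertAt-punchIn α i γ j))) ⟩
    γ ⊛ v i T ⊕ sum (λ j → α j ⊛ v (punchIn i j) T)                   ≡⟨ cong (γ ⊛ v i T ⊕_) (linComb-sum α (removeAt v i) T) ⟨
    γ ⊛ v i T ⊕ linComb α (removeAt v i) T                            ∎

  linComb-zero : (w : Fin d → MV) (T : Subset n) → linComb (λ _ → 0#) w T ≈ 0#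
  linComb-zero {d} w T = begin
    linComb (λ _ → 0#) w T   ≡⟨ linComb-sum (λ _ → 0#) w T ⟩
    sum (λ j → 0# ⊛ w j T)   ≈⟨ sum-cong-≋ (λ j → 𝔽.zeroˡ (w j T)) ⟩
    sum {d} (λ _ → 0#)       ≈⟨ sum-replicate-zero d ⟩
    0#                       ∎

  independent-nonzero : {v : Fin (suc d) → MV} → Independent v → ∀ i → ¬ v i ≈ᵥ 0ᵥ
  independent-nonzero {v = v} indep i vᵢ≈0 = 𝔽.1≉0 (𝔽.trans (𝔽.reflexive (sym (insertAt-lookup _ i 1#))) (indep eᵢ eᵢ·v≈0 i))
    where
    eᵢ = insertAt (λ _ → 0#) i 1#
    eᵢ·v≈0 : linComb eᵢ v ≈ᵥ 0ᵥ
    eᵢ·v≈0 T = begin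
      linComb eᵢ v T                                    ≈⟨ linComb-insertAt (λ _ → 0#) i 1# v T ⟩
      1# ⊛ v i T ⊕ linComb (λ _ → 0#) (removeAt v i) T
        ≈⟨ 𝔽.+-cong (𝔽.trans (𝔽.*-identityˡ _) (vᵢ≈0 T)) (linComb-zero (removeAt v i) T) ⟩
      0# ⊕ 0#                                           ≈⟨ 𝔽.+-identityʳ 0# ⟩
      0#                                                ∎

  eliminate-independent : {v : Fin (suc d) → MV} → Independent v → (i : Fin (suc d)) (κ : Fin d → Carrier) →
                          Independent (λ j → v (punchIn i j) +ᵥ (κ j · v i))
  eliminate-independent {v = v} indep i κ α α·w≈0 j =
    𝔽.trans (𝔽.reflexive (sym (insertAt-punchIn α i γ j))) (indep (insertAt α i γ) β·v≈0 (punchIn i j))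
    where
    γ = sum (λ j → α j ⊛ κ j)
    w = λ j → v (punchIn i j) +ᵥ (κ j · v i)
    β·v≈0 : linComb (insertAt α i γ) v ≈ᵥ 0ᵥ
    β·v≈0 T = begin
      linComb (insertAt α i γ) v T                                   ≈⟨ linComb-insertAt α i γ v T ⟩
      γ ⊛ v i T ⊕ linComb α (removeAt v i) T                         ≡⟨ cong (γ ⊛ v i T ⊕_) (linComb-sum α (removeAt v i) T) ⟩
      γ ⊛ v i T ⊕ sum (λ j → α j ⊛ v (punchIn i j) T)                ≈⟨ 𝔽.+-congʳ (*-distribʳ-sum (v i T) (λ j → α j ⊛ κ j)) ⟩
      sum (λ j → α j ⊛ κ j ⊛ v i T) ⊕ sum (λ j → α j ⊛ v (punchIn i j) T) ≈⟨ sum-distrib-+ (λ j → α j ⊛ κ j ⊛ v i T) _ ⟨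
      sum (λ j → α j ⊛ κ j ⊛ v i T ⊕ α j ⊛ v (punchIn i j) T)         ≈⟨ sum-cong-≋ (λ j → regroup (α j) (κ j) (v i T) _) ⟩
      sum (λ j → α j ⊛ (v (punchIn i j) T ⊕ κ j ⊛ v i T))             ≡⟨ linComb-sum α w T ⟨
      linComb α w T                                                  ≈⟨ α·w≈0 T ⟩
      0#                                                             ∎
      where
      regroup : ∀ a k x y → a ⊛ k ⊛ x ⊕ a ⊛ y ≈ a ⊛ (y ⊕ k ⊛ x)
      regroup a k x y = begin
        a ⊛ k ⊛ x ⊕ a ⊛ y    ≈⟨ 𝔽.+-comm _ _ ⟩
        a ⊛ y ⊕ a ⊛ k ⊛ x    ≈⟨ 𝔽.+-congˡ (𝔽.*-assoc a k x) ⟩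
        a ⊛ y ⊕ a ⊛ (k ⊛ x)  ≈⟨ 𝔽.distribˡ a y (k ⊛ x) ⟨
        a ⊛ (y ⊕ k ⊛ x)      ∎

  VanishingFrom : Subset n → MV → Set ℓ
  VanishingFrom S x = ∀ T → S ≤ˡ T → x T ≈ 0#

  vanishingFrom-isSubspace : (S : Subset n) → IsSubspace (VanishingFrom S)
  vanishingFrom-isSubspace S = record
    { resp  = λ x≈y x≈0 T S≤T → 𝔽.trans (𝔽.sym (x≈y T)) (x≈0 T S≤T)
    ; zero∈ = λ _ _ → 𝔽.refl
    ; +∈    = λ x≈0 y≈0 T S≤T → 𝔽.trans (𝔽.+-cong (x≈0 T S≤T) (y≈0 T S≤T)) (𝔽.+-identityʳ 0#)
    ; ·∈    = λ a x≈0 T S≤T → 𝔽.trans (𝔽.*-congˡ (x≈0 T S≤T)) (𝔽.zeroʳ a)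
    }

  ∩-isSubspace : ∀ {p q} {P : MV → Set p} {Q : MV → Set q} →
                 IsSubspace P → IsSubspace Q → IsSubspace (λ x → P x × Q x)
  ∩-isSubspace P-sub Q-sub = record
    { resp  = λ x≈y (Px , Qx) → P.resp x≈y Px , Q.resp x≈y Qx
    ; zero∈ = P.zero∈ , Q.zero∈
    ; +∈    = λ (Px , Qx) (Py , Qy) → P.+∈ Px Py , Q.+∈ Qx Qy
    ; ·∈    = λ a (Px , Qx) → P.·∈ a Px , Q.·∈ a Qx
    }
    where
    module P = IsSubspace P-sub
    module Q = IsSubspace Q-sub

  clearing : (u x : MV) (S : Subset n) → ¬ u S ≈ 0# → Σ Carrier λ κ → (x +ᵥ (κ · u)) S ≈ 0#
  clearing u x S uS≉0 = ⊝ (x S ⊛ u⁻¹) , (begin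
    x S ⊕ ⊝ (x S ⊛ u⁻¹) ⊛ u S   ≈⟨ 𝔽.+-congˡ (-‿distribˡ-* (x S ⊛ u⁻¹) (u S)) ⟨
    x S ⊕ ⊝ (x S ⊛ u⁻¹ ⊛ u S)   ≈⟨ 𝔽.+-congˡ (𝔽.-‿cong (𝔽.*-assoc (x S) u⁻¹ (u S))) ⟩
    x S ⊕ ⊝ (x S ⊛ (u⁻¹ ⊛ u S)) ≈⟨ 𝔽.+-congˡ (𝔽.-‿cong (𝔽.*-congˡ u⁻¹u≈1)) ⟩
    x S ⊕ ⊝ (x S ⊛ 1#)          ≈⟨ 𝔽.+-congˡ (𝔽.-‿cong (𝔽.*-identityʳ (x S))) ⟩
    x S ⊕ ⊝ x S                 ≈⟨ 𝔽.-‿inverseʳ (x S) ⟩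
    0#                          ∎)
    where
    u⁻¹ = proj₁ (𝔽.inverse (u S) uS≉0)
    u⁻¹u≈1 = 𝔽.trans (𝔽.*-comm u⁻¹ (u S)) (proj₂ (𝔽.inverse (u S) uS≉0))

  LeadingIn : ∀ {p} → (MV → Set p) → Subset n → Set (c ⊔ ℓ ⊔ p)
  LeadingIn P T = ∃ λ x → P x × Leading F x T

  LeadingSubsets : ∀ {p} → (MV → Set p) → ℕ → Set (c ⊔ ℓ ⊔ p)
  LeadingSubsets P d = Σ (Fin d → Subset n) λ T → Injective _≡_ _≡_ T × ∀ i → LeadingIn P (T i)

  cons-leading-subset : ∀ {p} {P : MV → Set p} {S} → LeadingIn P S →
                        LeadingSubsets (λ x → P x × VanishingFrom S x) d → LeadingSubsets P (suc d)
  cons-leading-subset {d = d} {P = P} {S} S-lead (T , T-inj , T-lead) = T′ , T′-inj , T′-lead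
    where
    T<S : ∀ j → T j <ˡ S
    T<S j with T-lead j
    ... | x , (_ , x-vanishes) , xT≉0 , _ with <ˡ-cmp (T j) S
    ...   | tri< T<S _ _ = T<S
    ...   | tri≈ _ T≡S _ = contradiction (x-vanishes (T j) (inj₂ (sym T≡S))) xT≉0
    ...   | tri> _ _ S<T = contradiction (x-vanishes (T j) (inj₁ S<T)) xT≉0
    T′ : Fin (suc d) → Subset n
    T′ zero    = S
    T′ (suc j) = T j
    T′-inj : Injective _≡_ _≡_ T′
    T′-inj {zero}  {zero}  _     = refl
    T′-inj {zero}  {suc j} S≡Tj  = contradiction (subst (_<ˡ S) (sym S≡Tj) (T<S j)) <ˡ-irrefl
    T′-inj {suc i} {zero}  Ti≡S  = contradiction (subst (_<ˡ S) Ti≡S (T<S i)) <ˡ-irrefl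
    T′-inj {suc i} {suc j} Ti≡Tj = cong suc (T-inj Ti≡Tj)
    T′-lead : ∀ i → LeadingIn P (T′ i)
    T′-lead zero    = S-lead
    T′-lead (suc j) = let x , (Px , _) , lead = T-lead j in x , Px , lead

  -- Pivot on the vector with the largest leading subset S, clear its S-coordinate from the
  -- others and recurse in the subspace of vectors vanishing from S upwards.
  echelon : ∀ {p} {P : MV → Set p} → IsSubspace P → (v : Fin d → MV) → (∀ i → P (v i)) → Independent v →
            ¬ ¬ LeadingSubsets P d
  echelon {zero}  _     _ _   _     = return ((λ ()) , (λ { {()} }) , λ ())
  echelon {suc d} {P = P} P-sub v v∈P indep = do
    leads ← ¬¬-choice (suc d) λ i → leading-subset F (v i) (independent-nonzero {v = v} indep i)
    let open Pivot leads
    rest ← echelon (∩-isSubspace P-sub (vanishingFrom-isSubspace S)) w w∈ (eliminate-independent {v = v} indep i κ)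
    return (cons-leading-subset (v i , v∈P i , proj₂ (leads i)) rest)
    where
    open IsSubspace P-sub
    module Pivot (leads : ∀ i → ∃ (Leading F (v i))) where
      i = proj₁ (argmax (proj₁ ∘ leads))
      S = proj₁ (leads i)
      κ : Fin d → Carrier
      κ j = proj₁ (clearing (v i) (v (punchIn i j)) S (proj₁ (proj₂ (leads i))))
      w : Fin d → MV
      w j = v (punchIn i j) +ᵥ (κ j · v i)
      above-S : ∀ k T → S <ˡ T → v k T ≈ 0#
      above-S k T S<T = proj₂ (proj₂ (leads k)) T (≤ˡ-<ˡ-trans (proj₂ (argmax (proj₁ ∘ leads)) k) S<T)
      w∈ : ∀ j → P (w j) × VanishingFrom S (w j)
      w∈ j = +∈ (v∈P (punchIn i j)) (·∈ (κ j) (v∈P i)) , vanishes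
        where
        vanishes : VanishingFrom S (w j)
        vanishes T (inj₂ refl) = proj₂ (clearing (v i) (v (punchIn i j)) S (proj₁ (proj₂ (leads i))))
        vanishes T (inj₁ S<T)  =
          𝔽.trans (𝔽.+-cong (above-S (punchIn i j) T S<T) (𝔽.trans (𝔽.*-congˡ (above-S i T S<T)) (𝔽.zeroʳ _)))
                  (𝔽.+-identityʳ 0#)

  positive-dimension : ∀ {p} {P : MV → Set p} {d} → HasDim P d → Σ MV (λ x → P x × ¬ x ≈ᵥ 0ᵥ) → 0 < d
  positive-dimension {d = zero}  (b , basis) (x , Px , x≉0) = contradiction (proj₂ (IsBasis.spanning basis x Px)) x≉0
  positive-dimension {d = suc d} _           _              = s≤s z≤n

  leading-size : ∀ {p} {P : MV → Set p} {k T} → (∀ x → P x → InDegree k x) → LeadingIn P T → ∣ T ∣ ≡ k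
  leading-size {k = k} {T} deg (x , Px , xT≉0 , _) = decidable-stable (∣ T ∣ ℕ.≟ k) λ ∣T∣≢k → xT≉0 (deg x Px T ∣T∣≢k)

  leading-subsets-pair : ∀ {p q} {K : MV → Set p} {L : MV → Set q} {k dK dL} → CrossAnnihilating K L →
                         (∀ x → K x → InDegree k x) → (∀ x → L x → InDegree k x) → 0 < dK → 0 < dL →
                         (T : Fin dK → Subset n) → (∀ i → LeadingIn K (T i)) →
                         (U : Fin dL → Subset n) → (∀ j → LeadingIn L (U j)) →
                         CrossIntersectingPair k (image T) (image U)
  leading-subsets-pair {k = k} K·L≈0 K-deg L-deg (s≤s _) (s≤s _) T T-lead U U-lead = record
    { uniformˡ  = λ X → image-∀ T (λ X → ∣ X ∣ ≡ k) (leading-size K-deg ∘ T-lead)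
    ; uniformʳ  = λ Y → image-∀ U (λ Y → ∣ Y ∣ ≡ k) (leading-size L-deg ∘ U-lead)
    ; cross     = λ X Y X∈ Y∈ → image-∀ T (λ X → meets X Y ≡ true)
                                  (λ i → image-∀ U (λ Y → meets (T i) Y ≡ true) (meet (T-lead i) ∘ U-lead) Y∈) X∈
    ; nonemptyˡ = T zero , image-∋ T zero
    ; nonemptyʳ = U zero , image-∋ U zero
    }
    where
    meet : ∀ {A B} → LeadingIn _ A → LeadingIn _ B → meets A B ≡ true
    meet (x , Kx , x-lead) (y , Ly , y-lead) = leading-meet x-lead y-lead (K·L≈0 x y Kx Ly)

m+n≤o+1⇒m≤o∸n+1 : ∀ {m n o} → m + n ≤ o + 1 → m ≤ o ∸ n + 1
m+n≤o+1⇒m≤o∸n+1 {m} {n} {o} m+n≤o+1 = ≤-trans (m+n≤o⇒m≤o∸n m m+n≤o+1) (m≤n+o⇒m∸n≤o (o + 1) n (begin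
  o + 1             ≤⟨ +-monoˡ-≤ 1 (m≤n+m∸n o n) ⟩
  n + (o ∸ n) + 1   ≡⟨ +-assoc n (o ∸ n) 1 ⟩
  n + (o ∸ n + 1)   ∎))
  where open ≤-Reasoning

theorem1p7 : ∀ {c ℓ p q : Level} (F : Field c ℓ) →
    ¬ (Field._≈_ F (Field._+_ F (Field.1# F) (Field.1# F)) (Field.0# F)) →
    ∀ (n k : ℕ) → 1 ≤ n → 2 * k ≤ n →
    ∀ (K : Exterior.MV F n → Set p) (L : Exterior.MV F n → Set q) →
    Exterior.IsSubspace F n K → Exterior.IsSubspace F n L →
    (∀ x → K x → Exterior.InDegree F n k x) →
    (∀ x → L x → Exterior.InDegree F n k x) →
    Σ (Exterior.MV F n) (λ x → K x × ¬ Exterior._≈ᵥ_ F n x (Exterior.0ᵥ F n)) →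
    Σ (Exterior.MV F n) (λ x → L x × ¬ Exterior._≈ᵥ_ F n x (Exterior.0ᵥ F n)) →
    Exterior.CrossAnnihilating F n K L →
    ∀ (dK dL : ℕ) → Exterior.HasDim F n K dK → Exterior.HasDim F n L dL →
    dK + dL ≤ (n C k) ∸ ((n ∸ k) C k) + 1
theorem1p7 F _ n k _ 2k≤n K L K-sub L-sub K-deg L-deg K≠0 L≠0 K·L≈0 dK dL hK@(bK , K-basis) hL@(bL , L-basis) =
  m+n≤o+1⇒m≤o∸n+1 (decidable-stable (dK + dL + (n ∸ k) C k ≤? n C k + 1) do
    T , T-inj , T-lead ← echelon F n K-sub bK (IsBasis.member K-basis) (IsBasis.linIndep K-basis)
    U , U-inj , U-lead ← echelon F n L-sub bL (IsBasis.member L-basis) (IsBasis.linIndep L-basis)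
    let pair = leading-subsets-pair F n K·L≈0 K-deg L-deg (positive-dimension F n hK K≠0)
                                    (positive-dimension F n hL L≠0) T T-lead U U-lead
    return (≤-trans (+-monoˡ-≤ ((n ∸ k) C k) (+-mono-≤ (injective-≤-count T T-inj (image-∋ T))
                                                         (injective-≤-count U U-inj (image-∋ U))))
                    (hilton-milner (subst (_≤ n) (cong (k +_) (+-identityʳ k)) 2k≤n) (image T) (image U) pair)))
  where open Exterior F n using (module IsBasis)
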